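{- Let $G=(V,E)$ be a finite graph with $N=|V|$, let $k\ge 2$, and let $s$ be a random $k$-cyclic signature obtained by choosing, independently for each edge $\{u,v\}$ (with a fixed orientation $(u,v)$), the value $s_{uv}$ uniformly from $S^1_k$ and setting $s_{vu}=\overline{s_{uv}}$. Then for any $i\in\{1,2,\dots,k-1\}$, $$\mathbb{E}_s\big(\det(xI-A^{s,i})\big)=\mu_G(x),$$ where $\mu_G(x)=\sum_{j=0}^{\lfloor N/2\rfloor}(-1)^j m_j x^{N-2j}$ is the matching polynomial of $G$ and $m_j$ is the number of $j$-matchings (sets of $j$ pairwise vertex-disjoint edges) in $G$.
   Context: $\xi=e^{2\pi i/k}$, $S^1_k=\{\xi^l:0\le l\le k-1\}$. A $k$-cyclic signature is a map $s$ from oriented edges to $S^1_k$ with $s_{vu}=\overline{s_{uv}}$. $A^{s,i}$ is the $N\times N$ Hermitian matrix with $(A^{s,i})_{uv}=(s_{uv})^i$ if $\{u,v\}\in E$ and $0$ otherwise. -}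

module Defs where

open import Level using (Level; _⊔_)
open import Data.Nat using (ℕ; zero; suc; _∸_; _<_; _≤_; _/_)
import Data.Nat as ℕ
open import Data.Fin using (Fin; zero; suc; toℕ; punchIn; _≟_)
open import Data.Fin.Properties using () renaming (_≟_ to _≟ᶠ_)
open import Data.Product using (_×_; _,_; proj₁; proj₂)
open import Data.Bool using (Bool; true; false; if_then_else_; _∧_; _∨_; not)
open import Data.List using (List; []; _∷_; map; concatMap; allFin; filterᵇ; length; foldr)
open import Relation.Nullary.Decidable using (⌊_⌋)
open import Relation.Binary.PropositionalEquality using (_≡_)
open import Function.Definitions using (Injective)
open import Algebra.Bundles using (CommutativeRing)
import Algebra.Bundles

-- A finite simple graph on vertex set V = Fin N with m edges.
-- Each edge {u,v} is stored once, with its fixed orientation (u,v), u < v.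
record Graph (N : ℕ) : Set where
  field
    m        : ℕ
    edge     : Fin m → Fin N × Fin N
    ordered  : ∀ e → toℕ (proj₁ (edge e)) < toℕ (proj₂ (edge e))
    distinct : Injective _≡_ _≡_ edge
open Graph public

allFuns : ∀ {a} {A : Set a} → List A → (m : ℕ) → List (Fin m → A)
allFuns xs zero    = (λ ()) ∷ []
allFuns xs (suc m) =
  concatMap (λ a → map (λ f → λ { zero → a ; (suc j) → f j }) (allFuns xs m)) xs

_==_ : ∀ {n} → Fin n → Fin n → Bool
a == b = ⌊ a ≟ᶠ b ⌋

size : ∀ {m} → (Fin m → Bool) → ℕ
size {zero}  S = 0
size {suc m} S = (if S zero then 1 else 0) ℕ.+ size (λ j → S (suc j))

allᵇ : ∀ {n} → (Fin n → Bool) → Bool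
allᵇ {zero}  p = true
allᵇ {suc n} p = p zero ∧ allᵇ (λ j → p (suc j))

shareVertex : ∀ {N} → Fin N × Fin N → Fin N × Fin N → Bool
shareVertex (a , b) (c , d) = (a == c) ∨ (a == d) ∨ (b == c) ∨ (b == d)

isMatching : ∀ {N} (G : Graph N) → (Fin (m G) → Bool) → Bool
isMatching G S =
  allᵇ (λ e → allᵇ (λ e' →
    not (S e ∧ S e' ∧ not (e == e') ∧ shareVertex (edge G e) (edge G e'))))

edgeSubsets : ∀ {N} (G : Graph N) → List (Fin (m G) → Bool)
edgeSubsets G = allFuns (true ∷ false ∷ []) (m G)

matchingNumber : ∀ {N} (G : Graph N) → ℕ → ℕ
matchingNumber G j =
  length (filterᵇ (λ S → isMatching G S ∧ ⌊ size S Data.Nat.≟ j ⌋) (edgeSubsets G))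

-- k-cyclic signatures: s assigns to each oriented edge (u,v) (as stored)
-- the exponent l, meaning s_uv = ξ^l, and s_vu = conj(ξ^l) = ξ^(k-l).
Signature : ∀ {N} → Graph N → ℕ → Set
Signature G k = Fin (m G) → Fin k

allSignatures : ∀ {N} (G : Graph N) (k : ℕ) → List (Signature G k)
allSignatures G k = allFuns (allFin k) (m G)

module WithRing {c ℓ : Level} (R : CommutativeRing c ℓ) where
  open CommutativeRing R hiding (zero)
  open import Algebra.Definitions.RawSemiring (Algebra.Bundles.Semiring.rawSemiring semiring) public
    using (_^_; sum) renaming (_×_ to _·ℕ_)

  Matrix : ℕ → Set c
  Matrix n = Fin n → Fin n → Carrier

  listSum : List Carrier → Carrier
  listSum = foldr _+_ 0#

  det : ∀ {n} → Matrix n → Carrier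
  det {zero}  M = 1#
  det {suc n} M =
    sum (λ j → ((- 1#) ^ toℕ j) * (M zero j * det (λ a b → M (suc a) (punchIn j b))))

  scalarMat : ∀ {n} → Carrier → Matrix n
  scalarMat x u v = if u == v then x else 0#

  sigAdj : ∀ {N} (G : Graph N) (k : ℕ) (ξ : Carrier) → Signature G k → ℕ → Matrix N
  sigAdj G k ξ s i u v =
    sum (λ e →
      (if (proj₁ (edge G e) == u) ∧ (proj₂ (edge G e) == v)
         then (ξ ^ toℕ (s e)) ^ i else 0#)
      + (if (proj₁ (edge G e) == v) ∧ (proj₂ (edge G e) == u)
         then (ξ ^ (k ∸ toℕ (s e))) ^ i else 0#))

  charPoly : ∀ {N} (G : Graph N) (k : ℕ) (ξ : Carrier) → Signature G k → ℕ → Carrier → Carrier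
  charPoly {N} G k ξ s i x = det (λ u v → scalarMat x u v - sigAdj G k ξ s i u v)

  matchingPoly : ∀ {N} (G : Graph N) → Carrier → Carrier
  matchingPoly {N} G x =
    sum {suc (N / 2)} (λ j →
      ((- 1#) ^ toℕ j) * ((matchingNumber G (toℕ j) ·ℕ 1#) * (x ^ (N ∸ 2 ℕ.* toℕ j))))

  NoZeroDivisors : Set (c ⊔ ℓ)
  NoZeroDivisors = ∀ a b → a * b ≈ 0# → Data.Sum._⊎_ (a ≈ 0#) (b ≈ 0#)
    where import Data.Sum

module Submission where

-- For W ⊆ V let M_W(s) be the matrix whose rows in W are those of xI - A^{s,i}
-- and whose other rows are those of the identity, so det M_W(s) is the
-- characteristic polynomial of the subgraph induced on W.  Write G = e₀ + G'
-- with e₀ = {u,v}.  By linearity of det in rows u and v, det M_W(s) is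
-- D₀ + α Dᵤ + β Dᵥ + αβ Dᵤᵥ, where α, β are (minus) the entries (ξ^a)^i,
-- (ξ^(k-a))^i carried by e₀ and D₀ = det M_W(s|G').  Averaging over s(e₀) = ξ^a
-- kills the α and β terms (a nontrivial root of unity has vanishing power sum),
-- αβ averages to [u,v ∈ W], and Dᵤᵥ = -det M_{W-u-v}(s|G') (a transposition).
-- Hence Σ_s det M_W(s) = k^m μ(E, W) for the deletion recurrence
-- μ(e₀E', W) = μ(E', W) - [u,v ∈ W] μ(E', W - u - v), μ(∅, W) = x^|W|.
-- Separately μ(E, W) is the signed sum over matchings inside W, which for
-- W = V is the matching polynomial.

open import Defs
open import Level using (Level)
open import Data.Nat using (ℕ; _≤_; _<_)
import Data.Nat
import Data.List
open import Relation.Nullary using (¬_)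
open import Algebra.Bundles using (CommutativeRing)

open import Data.Nat as ℕ using (zero; suc)
import Data.Nat.Properties as ℕₚ
open import Data.Nat.Solver using (module +-*-Solver)
open import Data.Nat.DivMod using (_/_; m*n/n≡m; /-monoˡ-≤)
open import Data.Fin as Fin using (Fin; zero; suc; toℕ; punchIn; punchOut; fromℕ<)
import Data.Fin.Properties as Finₚ
open import Data.Bool using (Bool; true; false; if_then_else_; _∧_; not)
open import Data.Product using (_×_; _,_; proj₁; proj₂)
open import Data.Sum using (inj₁; inj₂)
open import Data.List using (List; []; _∷_; map; concatMap; _++_; allFin; tabulate; filterᵇ; length)
import Data.List.Properties as Listₚ
open import Data.Empty using (⊥-elim)
open import Function using (_∘_)
open import Function.Definitions using (Injective)
open import Relation.Nullary using (yes; no; ⌊_⌋)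
open import Relation.Binary.PropositionalEquality as ≡ using (_≡_; _≢_)

==-refl : ∀ {n} (a : Fin n) → (a == a) ≡ true
==-refl a with a Finₚ.≟ a
... | yes _ = ≡.refl
... | no a≢a = ⊥-elim (a≢a ≡.refl)

==-≢ : ∀ {n} {a b : Fin n} → a ≢ b → (a == b) ≡ false
==-≢ {a = a} {b} a≢b with a Finₚ.≟ b
... | yes a≡b = ⊥-elim (a≢b a≡b)
... | no _ = ≡.refl

==-false⇒≢ : ∀ {n} {a b : Fin n} → (a == b) ≡ false → a ≢ b
==-false⇒≢ {a = a} h ≡.refl with ≡.trans (≡.sym h) (==-refl a)
... | ()

==-sym : ∀ {n} (a b : Fin n) → (a == b) ≡ (b == a)
==-sym a b with a Finₚ.≟ b
... | yes ≡.refl = ≡.sym (==-refl a)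
... | no a≢b = ≡.sym (==-≢ (a≢b ∘ ≡.sym))

==-false-sym : ∀ {n} {a b : Fin n} → (a == b) ≡ false → (b == a) ≡ false
==-false-sym {a = a} {b} a≠b = ≡.trans (==-sym b a) a≠b

==-punchIn : ∀ {n} (j : Fin (suc n)) (a b : Fin n) → (punchIn j a == punchIn j b) ≡ (a == b)
==-punchIn j a b with a Finₚ.≟ b
... | yes ≡.refl = ==-refl (punchIn j a)
... | no a≢b = ==-≢ (a≢b ∘ Finₚ.punchIn-injective j a b)

module Sums {c ℓ : Level} (R : CommutativeRing c ℓ) where
  open CommutativeRing R hiding (zero)
  open WithRing R
  open import Relation.Binary.Reasoning.Setoid setoid
  import Algebra.Solver.Ring.NaturalCoefficients.Default
  module Solver = Algebra.Solver.Ring.NaturalCoefficients.Default commutativeSemiring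
  open import Algebra.Properties.Semiring.Sum semiring public
    using (sum-cong-≋; ∑-distrib-+; *-distribˡ-sum; *-distribʳ-sum; sum-remove; sum-replicate; sum-replicate-zero)
  open import Algebra.Properties.Semiring.Mult semiring using (×-assoc-*; ×-congʳ)

  χ : Bool → Carrier
  χ b = if b then 1# else 0#

  χ-∧ : ∀ a b → χ (a ∧ b) ≈ χ a * χ b
  χ-∧ true b = sym (*-identityˡ _)
  χ-∧ false b = sym (zeroˡ _)

  listSum-cong : ∀ {a} {A : Set a} {f g : A → Carrier} (xs : List A) →
    (∀ y → f y ≈ g y) → listSum (map f xs) ≈ listSum (map g xs)
  listSum-cong [] h = refl
  listSum-cong (y ∷ xs) h = +-cong (h y) (listSum-cong xs h)

  listSum-++ : ∀ xs ys → listSum (xs ++ ys) ≈ listSum xs + listSum ys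
  listSum-++ [] ys = sym (+-identityˡ _)
  listSum-++ (y ∷ xs) ys = trans (+-congˡ (listSum-++ xs ys)) (sym (+-assoc _ _ _))

  listSum-+ : ∀ {a} {A : Set a} (f g : A → Carrier) (xs : List A) →
    listSum (map (λ y → f y + g y) xs) ≈ listSum (map f xs) + listSum (map g xs)
  listSum-+ f g [] = sym (+-identityˡ _)
  listSum-+ f g (y ∷ xs) = trans (+-congˡ (listSum-+ f g xs))
    (Solver.solve 4 (λ a b c d → (a :+ b) :+ (c :+ d) := (a :+ c) :+ (b :+ d)) refl _ _ _ _)
    where open Solver

  listSum-*ˡ : ∀ {a} {A : Set a} (r : Carrier) (f : A → Carrier) (xs : List A) →
    listSum (map (λ y → r * f y) xs) ≈ r * listSum (map f xs)
  listSum-*ˡ r f [] = sym (zeroʳ r)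
  listSum-*ˡ r f (y ∷ xs) = trans (+-congˡ (listSum-*ˡ r f xs)) (sym (distribˡ r _ _))

  listSum-linear : ∀ {a} {A : Set a} (r r' : Carrier) (f g : A → Carrier) (xs : List A) →
    listSum (map (λ y → r * f y + r' * g y) xs) ≈ r * listSum (map f xs) + r' * listSum (map g xs)
  listSum-linear r r' f g xs =
    trans (listSum-+ (λ y → r * f y) (λ y → r' * g y) xs) (+-cong (listSum-*ˡ r f xs) (listSum-*ˡ r' g xs))

  listSum-0 : ∀ {a} {A : Set a} (xs : List A) → listSum (map (λ _ → 0#) xs) ≈ 0#
  listSum-0 [] = refl
  listSum-0 (y ∷ xs) = trans (+-congˡ (listSum-0 xs)) (+-identityʳ 0#)

  listSum-swap : ∀ {a b} {A : Set a} {B : Set b} (F : A → B → Carrier) (xs : List A) (ys : List B) →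
    listSum (map (λ x → listSum (map (F x) ys)) xs) ≈ listSum (map (λ y → listSum (map (λ x → F x y) xs)) ys)
  listSum-swap F [] ys = sym (listSum-0 ys)
  listSum-swap F (x ∷ xs) ys = trans (+-congˡ (listSum-swap F xs ys)) (sym (listSum-+ (F x) _ ys))

  sum-listSum-swap : ∀ {a} {A : Set a} n (F : Fin n → A → Carrier) (xs : List A) →
    sum (λ j → listSum (map (F j) xs)) ≈ listSum (map (λ y → sum (λ j → F j y)) xs)
  sum-listSum-swap zero F xs = sym (listSum-0 xs)
  sum-listSum-swap (suc n) F xs =
    trans (+-congˡ (sum-listSum-swap n (F ∘ suc) xs)) (sym (listSum-+ (F zero) _ xs))

  listSum-tabulate : ∀ {n} (f : Fin n → Carrier) → listSum (tabulate f) ≈ sum f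
  listSum-tabulate {zero} f = refl
  listSum-tabulate {suc n} f = +-congˡ (listSum-tabulate (f ∘ suc))

  listSum-allFin : ∀ {n} (f : Fin n → Carrier) → listSum (map f (allFin n)) ≈ sum f
  listSum-allFin {n} f =
    trans (reflexive (≡.cong listSum (Listₚ.map-tabulate (λ j → j) f))) (listSum-tabulate f)

  listSum-concatMap : ∀ {a b} {A : Set a} {B : Set b} (g : B → Carrier) (h : A → List B) (xs : List A) →
    listSum (map g (concatMap h xs)) ≈ listSum (map (λ y → listSum (map g (h y))) xs)
  listSum-concatMap g h [] = refl
  listSum-concatMap g h (y ∷ xs) = begin
    listSum (map g (h y ++ concatMap h xs))
      ≈⟨ reflexive (≡.cong listSum (Listₚ.map-++ g (h y) (concatMap h xs))) ⟩
    listSum (map g (h y) ++ map g (concatMap h xs))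
      ≈⟨ listSum-++ (map g (h y)) _ ⟩
    listSum (map g (h y)) + listSum (map g (concatMap h xs))
      ≈⟨ +-congˡ (listSum-concatMap g h xs) ⟩
    listSum (map g (h y)) + listSum (map (λ y → listSum (map g (h y))) xs) ∎

  listSum-allFuns : ∀ {a} {A : Set a} (xs : List A) m (F : A → (Fin m → A) → Carrier) →
    listSum (map (λ s → F (s zero) (s ∘ suc)) (allFuns xs (suc m)))
      ≈ listSum (map (λ y → listSum (map (F y) (allFuns xs m))) xs)
  listSum-allFuns xs m F = trans (listSum-concatMap _ _ xs)
    (listSum-cong xs (λ y → reflexive (≡.cong listSum (≡.sym (Listₚ.map-∘ (allFuns xs m))))))

  sum-zero : ∀ {n} (f : Fin n → Carrier) → (∀ j → f j ≈ 0#) → sum f ≈ 0#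
  sum-zero {n} f h = trans (sum-cong-≋ h) (sum-replicate-zero n)

  sum-linear : ∀ {n} (f g h : Fin n → Carrier) (α β : Carrier) →
    (∀ j → f j ≈ α * g j + β * h j) → sum f ≈ α * sum g + β * sum h
  sum-linear f g h α β e = trans (sum-cong-≋ e)
    (trans (∑-distrib-+ (λ j → α * g j) (λ j → β * h j)) (+-cong (sym (*-distribˡ-sum α g)) (sym (*-distribˡ-sum β h))))

  sum-const : ∀ n (d : Carrier) → sum {n} (λ _ → d) ≈ (n ·ℕ 1#) * d
  sum-const n d = trans (sum-replicate n) (sym (trans (×-assoc-* n 1# d) (×-congʳ n (*-identityˡ d))))

  sum-bilinear : ∀ {n} (α β : Fin n → Carrier) (d₀ d₁ d₂ d₃ : Carrier) → sum α ≈ 0# → sum β ≈ 0# →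
    sum (λ a → d₀ + α a * d₁ + β a * d₂ + (α a * β a) * d₃) ≈ (n ·ℕ 1#) * d₀ + sum (λ a → α a * β a) * d₃
  sum-bilinear {n} α β d₀ d₁ d₂ d₃ Σα≈0 Σβ≈0 = begin
    sum (λ a → d₀ + α a * d₁ + β a * d₂ + (α a * β a) * d₃)
      ≈⟨ ∑-distrib-+ (λ a → d₀ + α a * d₁ + β a * d₂) (λ a → (α a * β a) * d₃) ⟩
    sum (λ a → d₀ + α a * d₁ + β a * d₂) + sum (λ a → (α a * β a) * d₃)
      ≈⟨ +-cong (∑-distrib-+ (λ a → d₀ + α a * d₁) (λ a → β a * d₂)) (sym (*-distribʳ-sum d₃ (λ a → α a * β a))) ⟩
    (sum (λ a → d₀ + α a * d₁) + sum (λ a → β a * d₂)) + sum (λ a → α a * β a) * d₃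
      ≈⟨ +-congʳ (+-cong (∑-distrib-+ (λ _ → d₀) (λ a → α a * d₁)) (vanishes β d₂ Σβ≈0)) ⟩
    ((sum {n} (λ _ → d₀) + sum (λ a → α a * d₁)) + 0#) + sum (λ a → α a * β a) * d₃
      ≈⟨ +-congʳ (trans (+-identityʳ _) (+-cong (sum-const n d₀) (vanishes α d₁ Σα≈0))) ⟩
    ((n ·ℕ 1#) * d₀ + 0#) + sum (λ a → α a * β a) * d₃
      ≈⟨ +-congʳ (+-identityʳ _) ⟩
    (n ·ℕ 1#) * d₀ + sum (λ a → α a * β a) * d₃ ∎
    where
    vanishes : ∀ (γ : Fin n → Carrier) d → sum γ ≈ 0# → sum (λ a → γ a * d) ≈ 0#
    vanishes γ d Σγ≈0 = trans (sym (*-distribʳ-sum d γ)) (trans (*-congʳ Σγ≈0) (zeroˡ d))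

  length-filter : ∀ {a} {A : Set a} (p : A → Bool) (xs : List A) (d : Carrier) →
    (length (filterᵇ p xs) ·ℕ 1#) * d ≈ listSum (map (λ y → χ (p y) * d) xs)
  length-filter p [] d = zeroˡ d
  length-filter p (y ∷ ys) d with p y
  ... | true = trans (distribʳ d 1# _) (+-cong refl (length-filter p ys d))
  ... | false = trans (length-filter p ys d) (sym (trans (+-congʳ (zeroˡ d)) (+-identityˡ _)))

  sum-pick : ∀ {n} (j₀ : Fin (suc n)) (f : Fin (suc n) → Carrier) → (∀ j → j ≢ j₀ → f j ≈ 0#) → sum f ≈ f j₀
  sum-pick j₀ f off = trans (sum-remove {i = j₀} f)
    (trans (+-congˡ (sum-zero (f ∘ punchIn j₀) (λ j → off (punchIn j₀ j) (Finₚ.punchInᵢ≢i j₀ j)))) (+-identityʳ _))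

punchIn-comm : ∀ {n} (u v : Fin (suc (suc n))) (u≢v : u ≢ v) (v≢u : v ≢ u) (b : Fin n) →
  punchIn u (punchIn (punchOut u≢v) b) ≡ punchIn v (punchIn (punchOut v≢u) b)
punchIn-comm zero zero u≢v v≢u b = ⊥-elim (u≢v ≡.refl)
punchIn-comm zero (suc v) u≢v v≢u b = ≡.refl
punchIn-comm (suc u) zero u≢v v≢u b = ≡.refl
punchIn-comm {zero} (suc zero) (suc zero) u≢v v≢u b = ⊥-elim (u≢v ≡.refl)
punchIn-comm {suc n} (suc u) (suc v) u≢v v≢u zero = ≡.refl
punchIn-comm {suc n} (suc u) (suc v) u≢v v≢u (suc b) =
  ≡.cong suc (punchIn-comm u v (u≢v ∘ ≡.cong suc) (v≢u ∘ ≡.cong suc) b)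

punchOut-sum : ∀ {n} (u v : Fin (suc n)) (u≢v : u ≢ v) (v≢u : v ≢ u) →
  toℕ (punchOut u≢v) ℕ.+ toℕ (punchOut v≢u) ℕ.+ 1 ≡ toℕ u ℕ.+ toℕ v
punchOut-sum zero zero u≢v v≢u = ⊥-elim (u≢v ≡.refl)
punchOut-sum {suc n} zero (suc v) u≢v v≢u = +-*-Solver.solve 1 (λ v → v :+ con 0 :+ con 1 := con 0 :+ (con 1 :+ v)) ≡.refl (toℕ v)
  where open +-*-Solver
punchOut-sum {suc n} (suc u) zero u≢v v≢u = +-*-Solver.solve 1 (λ u → con 0 :+ u :+ con 1 := (con 1 :+ u) :+ con 0) ≡.refl (toℕ u)
  where open +-*-Solver
punchOut-sum {suc n} (suc u) (suc v) u≢v v≢u = begin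
  suc a ℕ.+ suc b ℕ.+ 1 ≡⟨ solve 2 (λ a b → (con 1 :+ a) :+ (con 1 :+ b) :+ con 1 := con 2 :+ (a :+ b :+ con 1)) ≡.refl a b ⟩
  2 ℕ.+ (a ℕ.+ b ℕ.+ 1) ≡⟨ ≡.cong (2 ℕ.+_) (punchOut-sum u v (u≢v ∘ ≡.cong suc) (v≢u ∘ ≡.cong suc)) ⟩
  2 ℕ.+ (toℕ u ℕ.+ toℕ v) ≡⟨ solve 2 (λ u v → con 2 :+ (u :+ v) := (con 1 :+ u) :+ (con 1 :+ v)) ≡.refl (toℕ u) (toℕ v) ⟩
  suc (toℕ u) ℕ.+ suc (toℕ v) ∎
  where
  open ≡.≡-Reasoning
  open +-*-Solver
  a = toℕ (punchOut (u≢v ∘ ≡.cong suc))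
  b = toℕ (punchOut (v≢u ∘ ≡.cong suc))

module Determinants {c ℓ : Level} (R : CommutativeRing c ℓ) where
  open CommutativeRing R hiding (zero)
  open WithRing R
  open Sums R
  open import Relation.Binary.Reasoning.Setoid setoid
  open import Algebra.Properties.Ring ring using (-‿involutive; -1*x≈-x)
  open import Algebra.Properties.Semiring.Exp semiring using (^-homo-*; ^-congʳ)

  sgn : ℕ → Carrier
  sgn n = (- 1#) ^ n

  sgn-+ : ∀ a b → sgn (a ℕ.+ b) ≈ sgn a * sgn b
  sgn-+ = ^-homo-* (- 1#)

  sgn-double : ∀ a → sgn (a ℕ.+ a) ≈ 1#
  sgn-double zero = refl
  sgn-double (suc a) = begin
    (- 1#) * sgn (a ℕ.+ suc a)      ≈⟨ *-congˡ (^-congʳ (- 1#) (ℕₚ.+-suc a a)) ⟩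
    (- 1#) * ((- 1#) * sgn (a ℕ.+ a)) ≈⟨ *-congˡ (*-congˡ (sgn-double a)) ⟩
    (- 1#) * ((- 1#) * 1#)           ≈⟨ *-congˡ (*-identityʳ _) ⟩
    (- 1#) * (- 1#)                  ≈⟨ -1*x≈-x _ ⟩
    - (- 1#)                         ≈⟨ -‿involutive 1# ⟩
    1# ∎

  sgn-parity : ∀ a b x y → a ℕ.+ x ℕ.+ x ≡ b ℕ.+ y ℕ.+ y → sgn a ≈ sgn b
  sgn-parity a b x y e = begin
    sgn a                      ≈⟨ sym (*-identityʳ _) ⟩
    sgn a * 1#                 ≈⟨ *-congˡ (sym (sgn-double x)) ⟩
    sgn a * sgn (x ℕ.+ x)      ≈⟨ sym (sgn-+ a (x ℕ.+ x)) ⟩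
    sgn (a ℕ.+ (x ℕ.+ x))      ≈⟨ ^-congʳ (- 1#) (≡.trans (≡.sym (ℕₚ.+-assoc a x x)) (≡.trans e (ℕₚ.+-assoc b y y))) ⟩
    sgn (b ℕ.+ (y ℕ.+ y))      ≈⟨ sgn-+ b (y ℕ.+ y) ⟩
    sgn b * sgn (y ℕ.+ y)      ≈⟨ *-congˡ (sgn-double y) ⟩
    sgn b * 1#                 ≈⟨ *-identityʳ _ ⟩
    sgn b ∎

  minor : ∀ {n} → Fin (suc n) → Fin (suc n) → Matrix (suc n) → Matrix n
  minor r c X a b = X (punchIn r a) (punchIn c b)

  term : ∀ {n} → Matrix (suc n) → Fin (suc n) → Carrier
  term X j = sgn (toℕ j) * (X zero j * det (minor zero j X))

  unit : ∀ {n} → Fin n → Fin n → Carrier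
  unit c b = if b == c then 1# else 0#

  unit-≡ : ∀ {n} (c : Fin n) → unit c c ≈ 1#
  unit-≡ c rewrite ==-refl c = refl

  unit-≢ : ∀ {n} {b c : Fin n} → b ≢ c → unit c b ≈ 0#
  unit-≢ b≢c rewrite ==-≢ b≢c = refl

  unit-punchIn : ∀ {n} (j : Fin (suc n)) (c b : Fin n) → unit (punchIn j c) (punchIn j b) ≡ unit c b
  unit-punchIn j c b rewrite ==-punchIn j b c = ≡.refl

  setRow : ∀ {n} → Fin n → (Fin n → Carrier) → Matrix n → Matrix n
  setRow p r Y a b = if a == p then r b else Y a b

  setRow-at : ∀ {n} p r (Y : Matrix n) b → setRow p r Y p b ≡ r b
  setRow-at p r Y b rewrite ==-refl p = ≡.refl

  setRow-off : ∀ {n} p r (Y : Matrix n) {a} b → a ≢ p → setRow p r Y a b ≡ Y a b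
  setRow-off p r Y b a≢p rewrite ==-≢ a≢p = ≡.refl

  setRow-congʳ : ∀ {n} p r {Y Y' : Matrix n} → (∀ a b → Y a b ≈ Y' a b) → ∀ a b → setRow p r Y a b ≈ setRow p r Y' a b
  setRow-congʳ p r h a b with a == p
  ... | true = refl
  ... | false = h a b

  det-cong : ∀ {n} {X Y : Matrix n} → (∀ a b → X a b ≈ Y a b) → det X ≈ det Y
  det-cong {zero} h = refl
  det-cong {suc n} h = sum-cong-≋ (λ j → *-congˡ {sgn (toℕ j)} (*-cong (h zero j) (det-cong (λ a b → h (suc a) (punchIn j b)))))

  det-linear : ∀ {n} (p : Fin n) (X Y Z : Matrix n) (α β : Carrier) →
    (∀ b → X p b ≈ α * Y p b + β * Z p b) →
    (∀ a b → a ≢ p → X a b ≈ Y a b) → (∀ a b → a ≢ p → X a b ≈ Z a b) →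
    det X ≈ α * det Y + β * det Z
  -- row 0: linear in the entries of the first row, the minors agree
  det-linear {suc n} zero X Y Z α β hp hY hZ = sum-linear (term X) (term Y) (term Z) α β (λ j →
      termLinear (sgn (toℕ j)) (hp j) (det-cong (λ a b → hY (suc a) (punchIn j b) λ ()))
                               (det-cong (λ a b → hZ (suc a) (punchIn j b) λ ())))
    where
    termLinear : ∀ s {x y z d dy dz} → x ≈ α * y + β * z → d ≈ dy → d ≈ dz →
      s * (x * d) ≈ α * (s * (y * dy)) + β * (s * (z * dz))
    termLinear s {x} {y} {z} {d} {dy} {dz} ex ey ez = begin
      s * (x * d)                            ≈⟨ *-congˡ (*-congʳ ex) ⟩
      s * ((α * y + β * z) * d)              ≈⟨ solve 6 (λ s a b y z d → s :* ((a :* y :+ b :* z) :* d) := a :* (s :* (y :* d)) :+ b :* (s :* (z :* d))) refl s α β y z d ⟩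
      α * (s * (y * d)) + β * (s * (z * d))  ≈⟨ +-cong (*-congˡ (*-congˡ (*-congˡ ey))) (*-congˡ (*-congˡ (*-congˡ ez))) ⟩
      α * (s * (y * dy)) + β * (s * (z * dz)) ∎
      where open Solver
  -- other rows: the first rows agree, the minors are linear by induction
  det-linear {suc n} (suc p) X Y Z α β hp hY hZ = sum-linear (term X) (term Y) (term Z) α β (λ j →
      termLinear (sgn (toℕ j))
        (det-linear p (minor zero j X) (minor zero j Y) (minor zero j Z) α β
           (λ b → hp (punchIn j b))
           (λ a b a≢p → hY (suc a) (punchIn j b) (a≢p ∘ Finₚ.suc-injective))
           (λ a b a≢p → hZ (suc a) (punchIn j b) (a≢p ∘ Finₚ.suc-injective)))
        (hY zero j (λ ())) (hZ zero j (λ ())))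
    where
    termLinear : ∀ s {x y z d dy dz} → d ≈ α * dy + β * dz → x ≈ y → x ≈ z →
      s * (x * d) ≈ α * (s * (y * dy)) + β * (s * (z * dz))
    termLinear s {x} {y} {z} {d} {dy} {dz} ed ey ez = begin
      s * (x * d)                              ≈⟨ *-congˡ (*-congˡ ed) ⟩
      s * (x * (α * dy + β * dz))              ≈⟨ solve 6 (λ s a b x y z → s :* (x :* (a :* y :+ b :* z)) := a :* (s :* (x :* y)) :+ b :* (s :* (x :* z))) refl s α β x dy dz ⟩
      α * (s * (x * dy)) + β * (s * (x * dz))  ≈⟨ +-cong (*-congˡ (*-congˡ (*-congʳ ey))) (*-congˡ (*-congˡ (*-congʳ ez))) ⟩
      α * (s * (y * dy)) + β * (s * (z * dz))  ∎
      where open Solver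

  det-zero-row : ∀ {n} (p : Fin n) (X : Matrix n) → (∀ b → X p b ≈ 0#) → det X ≈ 0#
  det-zero-row p X h = begin
    det X                     ≈⟨ det-linear p X X X 0# 0# (λ b → trans (h b) (sym 0x+0x≈0)) (λ _ _ _ → refl) (λ _ _ _ → refl) ⟩
    0# * det X + 0# * det X   ≈⟨ 0x+0x≈0 ⟩
    0# ∎
    where
    0x+0x≈0 : ∀ {y z} → 0# * y + 0# * z ≈ 0#
    0x+0x≈0 = trans (+-cong (zeroˡ _) (zeroˡ _)) (+-identityˡ 0#)

  -- The sign bookkeeping of det-unitRow: after deleting row 0 / column u and then
  -- row r / column c', the accumulated sign is that of deleting row 1+r / column c
  -- and then row 0 / column j'.
  sgn-unitRow : ∀ u c r c' j' → c' ℕ.+ j' ℕ.+ 1 ≡ u ℕ.+ c →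
    sgn u * sgn (r ℕ.+ c') ≈ sgn (suc r ℕ.+ c) * sgn j'
  sgn-unitRow u c r c' j' H = begin
    sgn u * sgn (r ℕ.+ c')    ≈⟨ sym (sgn-+ u (r ℕ.+ c')) ⟩
    sgn (u ℕ.+ (r ℕ.+ c'))    ≈⟨ sgn-parity _ _ c c' parity ⟩
    sgn (suc r ℕ.+ c ℕ.+ j')  ≈⟨ sgn-+ (suc r ℕ.+ c) j' ⟩
    sgn (suc r ℕ.+ c) * sgn j' ∎
    where
    open +-*-Solver
    parity : u ℕ.+ (r ℕ.+ c') ℕ.+ c ℕ.+ c ≡ suc r ℕ.+ c ℕ.+ j' ℕ.+ c' ℕ.+ c'
    parity = ≡.trans (solve 4 (λ u r c' c → u :+ (r :+ c') :+ c :+ c := (u :+ c) :+ (r :+ c' :+ c)) ≡.refl u r c' c)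
      (≡.trans (≡.cong (ℕ._+ (r ℕ.+ c' ℕ.+ c)) (≡.sym H))
        (solve 4 (λ c' j r c → (c' :+ j :+ con 1) :+ (r :+ c' :+ c) := (con 1 :+ r) :+ c :+ j :+ c' :+ c') ≡.refl c' j' r c))

  det-unitRow : ∀ {n} (X : Matrix (suc n)) (r c : Fin (suc n)) → (∀ b → X r b ≈ unit c b) →
    det X ≈ sgn (toℕ r ℕ.+ toℕ c) * det (minor r c X)
  det-unitRow X zero c h = begin
    sum (term X)                                         ≈⟨ sum-remove {i = c} (term X) ⟩
    term X c + sum (λ j → term X (punchIn c j))          ≈⟨ +-cong (*-congˡ (*-congʳ (trans (h c) (unit-≡ c)))) (sum-zero _ off) ⟩
    sgn (toℕ c) * (1# * det (minor zero c X)) + 0#       ≈⟨ trans (+-identityʳ _) (*-congˡ (*-identityˡ _)) ⟩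
    sgn (toℕ c) * det (minor zero c X)                   ∎
    where
    off : ∀ j → term X (punchIn c j) ≈ 0#
    off j = trans (*-congˡ (trans (*-congʳ (trans (h _) (unit-≢ (Finₚ.punchInᵢ≢i c j)))) (zeroˡ _))) (zeroʳ _)
  det-unitRow {suc n} X (suc r) c h = begin
    sum (term X)                                         ≈⟨ sum-remove {i = c} (term X) ⟩
    term X c + sum (λ j → term X (punchIn c j))          ≈⟨ +-cong vanish (sum-cong-≋ step) ⟩
    0# + sum (λ j → σ * term (minor (suc r) c X) j)      ≈⟨ +-identityˡ _ ⟩
    sum (λ j → σ * term (minor (suc r) c X) j)           ≈⟨ sym (*-distribˡ-sum σ (term (minor (suc r) c X))) ⟩
    σ * det (minor (suc r) c X)                          ∎
    where
    σ = sgn (suc (toℕ r) ℕ.+ toℕ c)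
    -- the minor at column c has the zero row r
    vanish : term X c ≈ 0#
    vanish = trans (*-congˡ (trans (*-congˡ (det-zero-row r (minor zero c X)
               (λ b → trans (h (punchIn c b)) (unit-≢ (Finₚ.punchInᵢ≢i c b))))) (zeroʳ _))) (zeroʳ _)
    step : ∀ j → term X (punchIn c j) ≈ σ * term (minor (suc r) c X) j
    step j = begin
      sgn (toℕ u) * (X zero u * det (minor zero u X))
        ≈⟨ *-congˡ (*-congˡ IH) ⟩
      sgn (toℕ u) * (X zero u * (sgn (toℕ r ℕ.+ toℕ c') * det (minor r c' (minor zero u X))))
        ≈⟨ *-congˡ (*-congˡ (*-congˡ (det-cong (λ a b → reflexive (≡.cong (X (suc (punchIn r a))) (columns b)))))) ⟩
      sgn (toℕ u) * (X zero u * (sgn (toℕ r ℕ.+ toℕ c') * D))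
        ≈⟨ solve 4 (λ s x t d → s :* (x :* (t :* d)) := (s :* t) :* (x :* d)) refl _ _ _ _ ⟩
      (sgn (toℕ u) * sgn (toℕ r ℕ.+ toℕ c')) * (X zero u * D)
        ≈⟨ *-congʳ (sgn-unitRow (toℕ u) (toℕ c) (toℕ r) (toℕ c') (toℕ j) positions) ⟩
      (σ * sgn (toℕ j)) * (X zero u * D)
        ≈⟨ solve 4 (λ s t x d → (s :* t) :* (x :* d) := s :* (t :* (x :* d))) refl _ _ _ _ ⟩
      σ * (sgn (toℕ j) * (X zero u * D)) ∎
      where
      open Solver
      u = punchIn c j
      u≢c : u ≢ c
      u≢c = Finₚ.punchInᵢ≢i c j
      c' = punchOut u≢c
      D = det (minor zero j (minor (suc r) c X))
      j≡ : punchOut (u≢c ∘ ≡.sym) ≡ j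
      j≡ = ≡.trans (Finₚ.punchOut-cong c ≡.refl) (Finₚ.punchOut-punchIn c)
      columns : ∀ b → punchIn u (punchIn c' b) ≡ punchIn c (punchIn j b)
      columns b = ≡.trans (punchIn-comm u c u≢c (u≢c ∘ ≡.sym) b) (≡.cong (λ t → punchIn c (punchIn t b)) j≡)
      row : ∀ b → minor zero u X r b ≈ unit c' b
      row b = trans (h (punchIn u b)) (reflexive (≡.trans
        (≡.cong (λ t → unit t (punchIn u b)) (≡.sym (Finₚ.punchIn-punchOut u≢c))) (unit-punchIn u c' b)))
      IH : det (minor zero u X) ≈ sgn (toℕ r ℕ.+ toℕ c') * det (minor r c' (minor zero u X))
      IH = det-unitRow (minor zero u X) r c' row
      positions : toℕ c' ℕ.+ toℕ j ℕ.+ 1 ≡ toℕ u ℕ.+ toℕ c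
      positions = ≡.subst (λ t → toℕ c' ℕ.+ toℕ t ℕ.+ 1 ≡ toℕ u ℕ.+ toℕ c) j≡ (punchOut-sum u c u≢c (u≢c ∘ ≡.sym))

  -- Two rows u ≠ v that are the basis vectors e_v and e_u contribute a sign -1
  -- compared with the rows e_u and e_v: a transposition of columns.
  det-swapUnits : ∀ {n} (Y : Matrix n) (u v : Fin n) → u ≢ v →
    det (setRow u (unit v) (setRow v (unit u) Y)) ≈ - det (setRow u (unit u) (setRow v (unit v) Y))
  det-swapUnits {suc zero} Y zero zero u≢v = ⊥-elim (u≢v ≡.refl)
  det-swapUnits {suc (suc n)} Y u v u≢v = begin
    det X
      ≈⟨ det-unitRow X u v (λ b → reflexive (setRow-at u (unit v) (setRow v (unit u) Y) b)) ⟩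
    sgn (toℕ u ℕ.+ toℕ v) * det (minor u v X)
      ≈⟨ *-congˡ (det-unitRow (minor u v X) r' c' rowX) ⟩
    sgn (toℕ u ℕ.+ toℕ v) * (sgn (toℕ r' ℕ.+ toℕ c') * det (minor r' c' (minor u v X)))
      ≈⟨ sym (*-assoc _ _ _) ⟩
    (sgn (toℕ u ℕ.+ toℕ v) * sgn (toℕ r' ℕ.+ toℕ c')) * det (minor r' c' (minor u v X))
      ≈⟨ *-cong odd (det-cong same) ⟩
    (- 1#) * det (minor r' r' (minor u u X'))
      ≈⟨ -1*x≈-x _ ⟩
    - det (minor r' r' (minor u u X'))
      ≈⟨ -‿cong (sym even) ⟩
    - det X' ∎
    where
    X = setRow u (unit v) (setRow v (unit u) Y)
    X' = setRow u (unit u) (setRow v (unit v) Y)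
    v≢u = u≢v ∘ ≡.sym
    r' = punchOut u≢v
    c' = punchOut v≢u
    r'↑ : punchIn u r' ≡ v
    r'↑ = Finₚ.punchIn-punchOut u≢v
    c'↑ : punchIn v c' ≡ u
    c'↑ = Finₚ.punchIn-punchOut v≢u
    rowX : ∀ b → minor u v X r' b ≈ unit c' b
    rowX b = (begin
      X (punchIn u r') (punchIn v b)   ≡⟨ ≡.cong (λ t → X t (punchIn v b)) r'↑ ⟩
      X v (punchIn v b)                ≡⟨ setRow-off u (unit v) (setRow v (unit u) Y) (punchIn v b) v≢u ⟩
      setRow v (unit u) Y v (punchIn v b) ≡⟨ setRow-at v (unit u) Y (punchIn v b) ⟩
      unit u (punchIn v b)             ≡⟨ ≡.cong (λ t → unit t (punchIn v b)) (≡.sym c'↑) ⟩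
      unit (punchIn v c') (punchIn v b) ≡⟨ unit-punchIn v c' b ⟩
      unit c' b ∎)
    rowX' : ∀ b → minor u u X' r' b ≈ unit r' b
    rowX' b = (begin
      X' (punchIn u r') (punchIn u b)  ≡⟨ ≡.cong (λ t → X' t (punchIn u b)) r'↑ ⟩
      X' v (punchIn u b)               ≡⟨ setRow-off u (unit u) (setRow v (unit v) Y) (punchIn u b) v≢u ⟩
      setRow v (unit v) Y v (punchIn u b) ≡⟨ setRow-at v (unit v) Y (punchIn u b) ⟩
      unit v (punchIn u b)             ≡⟨ ≡.cong (λ t → unit t (punchIn u b)) (≡.sym r'↑) ⟩
      unit (punchIn u r') (punchIn u b) ≡⟨ unit-punchIn u r' b ⟩
      unit r' b ∎)
    -- away from rows u and v, X and X' both agree with Y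
    same : ∀ a b → minor r' c' (minor u v X) a b ≈ minor r' r' (minor u u X') a b
    same a b = begin
      X p (punchIn v (punchIn c' b))    ≡⟨ ≡.cong (X p) (punchIn-comm v u v≢u u≢v b) ⟩
      X p q                             ≡⟨ setRow-off u (unit v) (setRow v (unit u) Y) q p≢u ⟩
      setRow v (unit u) Y p q           ≡⟨ setRow-off v (unit u) Y q p≢v ⟩
      Y p q                             ≡⟨ ≡.sym (setRow-off v (unit v) Y q p≢v) ⟩
      setRow v (unit v) Y p q           ≡⟨ ≡.sym (setRow-off u (unit u) (setRow v (unit v) Y) q p≢u) ⟩
      X' p q                            ∎
      where
      p = punchIn u (punchIn r' a)
      q = punchIn u (punchIn r' b)
      p≢u : p ≢ u
      p≢u = Finₚ.punchInᵢ≢i u (punchIn r' a)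
      p≢v : p ≢ v
      p≢v e = Finₚ.punchInᵢ≢i r' a (Finₚ.punchIn-injective u _ _ (≡.trans e (≡.sym r'↑)))
    odd : sgn (toℕ u ℕ.+ toℕ v) * sgn (toℕ r' ℕ.+ toℕ c') ≈ - 1#
    odd = trans (sym (sgn-+ (toℕ u ℕ.+ toℕ v) _)) (trans (sgn-parity _ 1 0 s parity) (*-identityʳ _))
      where
      open +-*-Solver
      s = toℕ r' ℕ.+ toℕ c'
      parity : toℕ u ℕ.+ toℕ v ℕ.+ s ℕ.+ 0 ℕ.+ 0 ≡ 1 ℕ.+ s ℕ.+ s
      parity = ≡.trans (≡.cong (λ t → t ℕ.+ s ℕ.+ 0 ℕ.+ 0) (≡.sym (punchOut-sum u v u≢v v≢u)))
        (solve 1 (λ s → s :+ con 1 :+ s :+ con 0 :+ con 0 := con 1 :+ s :+ s) ≡.refl s)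
    even : det X' ≈ det (minor r' r' (minor u u X'))
    even = begin
      det X' ≈⟨ det-unitRow X' u u (λ b → reflexive (setRow-at u (unit u) (setRow v (unit v) Y) b)) ⟩
      sgn (toℕ u ℕ.+ toℕ u) * det (minor u u X')
        ≈⟨ *-cong (sgn-double (toℕ u)) (det-unitRow (minor u u X') r' r' rowX') ⟩
      1# * (sgn (toℕ r' ℕ.+ toℕ r') * det (minor r' r' (minor u u X')))
        ≈⟨ trans (*-identityˡ _) (trans (*-congʳ (sgn-double (toℕ r'))) (*-identityˡ _)) ⟩
      det (minor r' r' (minor u u X')) ∎

  diagProduct : ∀ {n} → (Fin n → Carrier) → Carrier
  diagProduct {zero} d = 1#
  diagProduct {suc n} d = d zero * diagProduct (d ∘ suc)

  det-diagonal : ∀ {n} (X : Matrix n) (d : Fin n → Carrier) → (∀ a b → X a b ≈ unit a b * d a) →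
    det X ≈ diagProduct d
  det-diagonal {zero} X d h = refl
  det-diagonal {suc n} X d h = begin
    term X zero + sum (λ j → term X (suc j))
      ≈⟨ +-cong (*-identityˡ _) (sum-zero (λ j → term X (suc j)) offDiagonal) ⟩
    X zero zero * det (minor zero zero X) + 0#
      ≈⟨ +-identityʳ _ ⟩
    X zero zero * det (minor zero zero X)
      ≈⟨ *-cong (trans (h zero zero) (trans (*-congʳ (unit-≡ {suc n} zero)) (*-identityˡ _)))
                (det-diagonal (minor zero zero X) (d ∘ suc)
                   (λ a b → trans (h (suc a) (suc b)) (*-congʳ (reflexive (unit-punchIn zero a b))))) ⟩
    d zero * diagProduct (d ∘ suc) ∎
    where
    offDiagonal : ∀ j → term X (suc j) ≈ 0#
    offDiagonal j = trans (*-congˡ (trans (*-congʳ (trans (h zero (suc j))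
      (trans (*-congʳ (unit-≢ {b = suc j} {c = zero} λ ())) (zeroˡ _)))) (zeroˡ _))) (zeroʳ _)

  rowCases : ∀ {n p} (r : Fin n) {P : Fin n → Set p} → P r → (∀ a → a ≢ r → P a) → ∀ a → P a
  rowCases r at off a with a Finₚ.≟ r
  ... | yes ≡.refl = at
  ... | no a≢r = off a a≢r

  det-twoRows : ∀ {n} (X Y : Matrix n) (u v : Fin n) → u ≢ v → (α β : Carrier) (r q : Fin n → Carrier) →
    (∀ b → X u b ≈ Y u b + α * r b) → (∀ b → X v b ≈ Y v b + β * q b) →
    (∀ a b → a ≢ u → a ≢ v → X a b ≈ Y a b) →
    det X ≈ det Y + α * det (setRow u r Y) + β * det (setRow v q Y)
            + (α * β) * det (setRow u r (setRow v q Y))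
  det-twoRows X Y u v u≢v α β r q rowU rowV rest = begin
    det X
      ≈⟨ det-linear u X X₁ X₂ 1# α splitU (λ a b a≢u → sym (≡⇒≈ (setRow-off u (Y u) X b a≢u)))
                                          (λ a b a≢u → sym (≡⇒≈ (setRow-off u r X b a≢u))) ⟩
    1# * det X₁ + α * det X₂
      ≈⟨ +-cong (*-congˡ (det-linear v X₁ Y Yv 1# β (splitV X₁ Y Yv (λ b → setRow-off u (Y u) X b v≢u) (λ _ → ≡.refl) (setRow-at v q Y))
                            (λ a b a≢v → X₁≈Y a b a≢v) (λ a b a≢v → trans (X₁≈Y a b a≢v) (sym (≡⇒≈ (setRow-off v q Y b a≢v))))))
                (*-congˡ (det-linear v X₂ Yu Yuv 1# β (splitV X₂ Yu Yuv (λ b → setRow-off u r X b v≢u) (λ b → setRow-off u r Y b v≢u)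
                                                          (λ b → ≡.trans (setRow-off u r Yv b v≢u) (setRow-at v q Y b)))
                            (λ a b → X₂≈ Yu (λ b → ≡.sym (setRow-at u r Y b)) (λ a' b' a'≢u _ → ≡.sym (setRow-off u r Y b' a'≢u)) a b)
                            (λ a b → X₂≈ Yuv (λ b → ≡.sym (setRow-at u r Yv b))
                                        (λ a' b' a'≢u a'≢v → ≡.sym (≡.trans (setRow-off u r Yv b' a'≢u) (setRow-off v q Y b' a'≢v))) a b))) ⟩
    1# * (1# * det Y + β * det Yv) + α * (1# * det Yu + β * det Yuv)
      ≈⟨ +-cong (trans (*-identityˡ _) (+-congʳ (*-identityˡ _))) (*-congˡ (+-congʳ (*-identityˡ _))) ⟩
    (det Y + β * det Yv) + α * (det Yu + β * det Yuv)
      ≈⟨ solve 6 (λ y b yv a yu yuv → (y :+ b :* yv) :+ a :* (yu :+ b :* yuv)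
                                       := y :+ a :* yu :+ b :* yv :+ (a :* b) :* yuv) refl (det Y) β (det Yv) α (det Yu) (det Yuv) ⟩
    det Y + α * det Yu + β * det Yv + (α * β) * det Yuv ∎
    where
    open Solver
    ≡⇒≈ = reflexive
    v≢u = u≢v ∘ ≡.sym
    X₁ = setRow u (Y u) X
    X₂ = setRow u r X
    Yu = setRow u r Y
    Yv = setRow v q Y
    Yuv = setRow u r Yv
    splitU : ∀ b → X u b ≈ 1# * X₁ u b + α * X₂ u b
    splitU b = trans (rowU b) (+-cong (sym (trans (*-identityˡ _) (≡⇒≈ (setRow-at u (Y u) X b))))
                                      (*-congˡ (sym (≡⇒≈ (setRow-at u r X b)))))
    splitV : ∀ (Z Z₁ Z₂ : Matrix _) → (∀ b → Z v b ≡ X v b) → (∀ b → Z₁ v b ≡ Y v b) → (∀ b → Z₂ v b ≡ q b) →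
      ∀ b → Z v b ≈ 1# * Z₁ v b + β * Z₂ v b
    splitV Z Z₁ Z₂ zv z₁v z₂v b = trans (≡⇒≈ (zv b)) (trans (rowV b)
      (+-cong (sym (trans (*-identityˡ _) (≡⇒≈ (z₁v b)))) (*-congˡ (sym (≡⇒≈ (z₂v b))))))
    X₁≈Y : ∀ a b → a ≢ v → X₁ a b ≈ Y a b
    X₁≈Y = rowCases u (λ b _ → ≡⇒≈ (setRow-at u (Y u) X b))
                      (λ a a≢u b a≢v → trans (≡⇒≈ (setRow-off u (Y u) X b a≢u)) (rest a b a≢u a≢v))
    X₂≈ : ∀ (Z : Matrix _) → (∀ b → r b ≡ Z u b) → (∀ a b → a ≢ u → a ≢ v → Y a b ≡ Z a b) → ∀ a b → a ≢ v → X₂ a b ≈ Z a b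
    X₂≈ Z zu zrest = rowCases u (λ b _ → ≡⇒≈ (≡.trans (setRow-at u r X b) (zu b)))
                      (λ a a≢u b a≢v → trans (≡⇒≈ (setRow-off u r X b a≢u)) (trans (rest a b a≢u a≢v) (≡⇒≈ (zrest a b a≢u a≢v))))

module RootsOfUnity {c ℓ : Level} (R : CommutativeRing c ℓ) where
  open CommutativeRing R hiding (zero)
  open WithRing R
  open Sums R
  open import Relation.Binary.Reasoning.Setoid setoid
  open import Algebra.Properties.Semiring.Sum semiring using (sum-init-last)
  open import Algebra.Properties.Semiring.Exp semiring using (^-homo-*; ^-congʳ; ^-congˡ; ^-assocʳ)
  open import Algebra.Properties.CommutativeSemiring.Exp commutativeSemiring using (^-distrib-*)
  open import Algebra.Properties.Ring ring using (-1*x≈-x)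
  open import Algebra.Properties.Group +-group using (x∙y⁻¹≈ε⇒x≈y; ∙-cancelˡ)

  1^n≈1 : ∀ n → 1# ^ n ≈ 1#
  1^n≈1 zero = refl
  1^n≈1 (suc n) = trans (*-identityˡ _) (1^n≈1 n)

  ^-swap : ∀ ζ a b → (ζ ^ a) ^ b ≈ (ζ ^ b) ^ a
  ^-swap ζ a b = trans (^-assocʳ ζ a b) (trans (^-congʳ ζ (ℕₚ.*-comm a b)) (sym (^-assocʳ ζ b a)))

  root-^ : ∀ ζ n b → ζ ^ n ≈ 1# → (ζ ^ b) ^ n ≈ 1#
  root-^ ζ n b ζⁿ≈1 = trans (^-swap ζ b n) (trans (^-congˡ b ζⁿ≈1) (1^n≈1 b))

  powerSum : Carrier → ℕ → Carrier
  powerSum ζ n = sum {n} (λ t → ζ ^ toℕ t)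

  powerSum-head : ∀ ζ n → powerSum ζ (suc n) ≈ 1# + ζ * powerSum ζ n
  powerSum-head ζ n = +-congˡ (sym (*-distribˡ-sum {n} ζ (λ t → ζ ^ toℕ t)))

  powerSum-last : ∀ ζ n → powerSum ζ (suc n) ≈ powerSum ζ n + ζ ^ n
  powerSum-last ζ n = trans (sum-init-last {n} (λ t → ζ ^ toℕ t))
    (+-cong (sum-cong-≋ {n} (λ t → reflexive (≡.cong (ζ ^_) (Finₚ.toℕ-inject₁ t))))
            (reflexive (≡.cong (ζ ^_) (Finₚ.toℕ-fromℕ n))))

  -- In a ring without zero divisors the powers of an n-th root of unity ζ ≠ 1
  -- sum to zero, since (ζ - 1) · powerSum ζ n = ζ^n - 1 = 0.
  powerSum-root : NoZeroDivisors → ∀ ζ n → ζ ^ n ≈ 1# → ¬ (ζ ≈ 1#) → powerSum ζ n ≈ 0#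
  powerSum-root noZeroDivisors ζ n ζⁿ≈1 ζ≉1 with noZeroDivisors (ζ - 1#) S factored
    where
    S = powerSum ζ n
    shift : ζ * S ≈ S
    shift = ∙-cancelˡ 1# (ζ * S) S (begin
      1# + ζ * S       ≈⟨ sym (powerSum-head ζ n) ⟩
      powerSum ζ (suc n) ≈⟨ powerSum-last ζ n ⟩
      S + ζ ^ n        ≈⟨ +-congˡ ζⁿ≈1 ⟩
      S + 1#           ≈⟨ +-comm S 1# ⟩
      1# + S           ∎)
    factored : (ζ - 1#) * S ≈ 0#
    factored = begin
      (ζ - 1#) * S       ≈⟨ distribʳ S ζ (- 1#) ⟩
      ζ * S + (- 1#) * S ≈⟨ +-cong shift (-1*x≈-x S) ⟩
      S - S              ≈⟨ -‿inverseʳ S ⟩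
      0#                 ∎
  ... | inj₁ ζ-1≈0 = ⊥-elim (ζ≉1 (x∙y⁻¹≈ε⇒x≈y ζ 1# ζ-1≈0))
  ... | inj₂ S≈0 = S≈0

  -- The entries of A^{s,i} at (u,v) and at (v,u) for an edge with s_uv = ξ^a.
  weight weight' : (k : ℕ) → Carrier → ℕ → Fin k → Carrier
  weight k ξ i a = (ξ ^ toℕ a) ^ i
  weight' k ξ i a = (ξ ^ (k ℕ.∸ toℕ a)) ^ i

  module Characters (noZeroDivisors : NoZeroDivisors) (k : ℕ) (ξ : Carrier) (ξᵏ≈1 : ξ ^ k ≈ 1#)
                    (ξ-primitive : ∀ j → 1 ℕ.≤ j → j ℕ.< k → ¬ (ξ ^ j ≈ 1#))
                    (i : ℕ) (1≤i : 1 ℕ.≤ i) (i<k : i ℕ.< k) where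

    -- ν = ξ^(k-1) is the inverse of ξ
    ν : Carrier
    ν = ξ ^ (k ℕ.∸ 1)

    νξ≈1 : ν * ξ ≈ 1#
    νξ≈1 = begin
      ν * ξ                       ≈⟨ *-comm ν ξ ⟩
      ξ * ν                       ≈⟨ *-congʳ (sym (*-identityʳ ξ)) ⟩
      ξ ^ 1 * ν                   ≈⟨ sym (^-homo-* ξ 1 (k ℕ.∸ 1)) ⟩
      ξ ^ (1 ℕ.+ (k ℕ.∸ 1))       ≈⟨ ^-congʳ ξ (ℕₚ.m+[n∸m]≡n (ℕₚ.≤-trans 1≤i (ℕₚ.<⇒≤ i<k))) ⟩
      ξ ^ k                       ≈⟨ ξᵏ≈1 ⟩
      1#                          ∎

    ξ^[k∸a]≈ν^a : ∀ a → a ℕ.≤ k → ξ ^ (k ℕ.∸ a) ≈ ν ^ a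
    ξ^[k∸a]≈ν^a a a≤k = begin
      ξ ^ (k ℕ.∸ a)                       ≈⟨ sym (*-identityˡ _) ⟩
      1# * ξ ^ (k ℕ.∸ a)                  ≈⟨ *-congʳ (sym (trans (^-congˡ a νξ≈1) (1^n≈1 a))) ⟩
      (ν * ξ) ^ a * ξ ^ (k ℕ.∸ a)         ≈⟨ *-congʳ (^-distrib-* ν ξ a) ⟩
      (ν ^ a * ξ ^ a) * ξ ^ (k ℕ.∸ a)     ≈⟨ *-assoc _ _ _ ⟩
      ν ^ a * (ξ ^ a * ξ ^ (k ℕ.∸ a))     ≈⟨ *-congˡ (sym (^-homo-* ξ a (k ℕ.∸ a))) ⟩
      ν ^ a * ξ ^ (a ℕ.+ (k ℕ.∸ a))       ≈⟨ *-congˡ (trans (^-congʳ ξ (ℕₚ.m+[n∸m]≡n a≤k)) ξᵏ≈1) ⟩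
      ν ^ a * 1#                          ≈⟨ *-identityʳ _ ⟩
      ν ^ a                               ∎

    ξⁱ≉1 : ¬ (ξ ^ i ≈ 1#)
    ξⁱ≉1 = ξ-primitive i 1≤i i<k

    νⁱ≉1 : ¬ (ν ^ i ≈ 1#)
    νⁱ≉1 νⁱ≈1 = ξⁱ≉1 (begin
      ξ ^ i              ≈⟨ sym (*-identityˡ _) ⟩
      1# * ξ ^ i         ≈⟨ *-congʳ (sym νⁱ≈1) ⟩
      ν ^ i * ξ ^ i      ≈⟨ sym (^-distrib-* ν ξ i) ⟩
      (ν * ξ) ^ i        ≈⟨ ^-congˡ i νξ≈1 ⟩
      1# ^ i             ≈⟨ 1^n≈1 i ⟩
      1#                 ∎)

    νᵏ≈1 : ν ^ k ≈ 1#
    νᵏ≈1 = root-^ ξ k (k ℕ.∸ 1) ξᵏ≈1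

    weight-sum : sum (weight k ξ i) ≈ 0#
    weight-sum = trans (sum-cong-≋ {k} (λ a → ^-swap ξ (toℕ a) i))
                  (powerSum-root noZeroDivisors (ξ ^ i) k (root-^ ξ k i ξᵏ≈1) ξⁱ≉1)

    weight'-sum : sum (weight' k ξ i) ≈ 0#
    weight'-sum = trans (sum-cong-≋ {k} (λ a → trans (^-congˡ i (ξ^[k∸a]≈ν^a (toℕ a) (ℕₚ.<⇒≤ (Finₚ.toℕ<n a))))
                                            (^-swap ν (toℕ a) i)))
                   (powerSum-root noZeroDivisors (ν ^ i) k (root-^ ν k i νᵏ≈1) νⁱ≉1)

    weight-product : ∀ a → weight k ξ i a * weight' k ξ i a ≈ 1#
    weight-product a = begin
      weight k ξ i a * weight' k ξ i a                           ≈⟨ sym (^-distrib-* _ _ i) ⟩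
      (ξ ^ toℕ a * ξ ^ (k ℕ.∸ toℕ a)) ^ i   ≈⟨ ^-congˡ i (sym (^-homo-* ξ (toℕ a) _)) ⟩
      (ξ ^ (toℕ a ℕ.+ (k ℕ.∸ toℕ a))) ^ i   ≈⟨ ^-congˡ i (^-congʳ ξ (ℕₚ.m+[n∸m]≡n (ℕₚ.<⇒≤ (Finₚ.toℕ<n a)))) ⟩
      (ξ ^ k) ^ i                           ≈⟨ trans (^-congˡ i ξᵏ≈1) (1^n≈1 i) ⟩
      1#                                    ∎

∧-true : ∀ {a b} → a ∧ b ≡ true → a ≡ true × b ≡ true
∧-true {true} {true} _ = ≡.refl , ≡.refl

true≢false : true ≢ false
true≢false ()

allᵇ-elim : ∀ {n} (P : Fin n → Bool) → allᵇ P ≡ true → ∀ j → P j ≡ true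
allᵇ-elim {suc n} P h zero = proj₁ (∧-true {P zero} h)
allᵇ-elim {suc n} P h (suc j) = allᵇ-elim (P ∘ suc) (proj₂ (∧-true {P zero} h)) j

allᵇ-intro : ∀ {n} (P : Fin n → Bool) → (∀ j → P j ≡ true) → allᵇ P ≡ true
allᵇ-intro {zero} P h = ≡.refl
allᵇ-intro {suc n} P h rewrite h zero = allᵇ-intro (P ∘ suc) (h ∘ suc)

module VertexSets where

  removeVertex : ∀ {n} → Fin n → (Fin n → Bool) → (Fin n → Bool)
  removeVertex p W q = not (q == p) ∧ W q

  removeEdge : ∀ {n} → Fin n → Fin n → (Fin n → Bool) → (Fin n → Bool)
  removeEdge u v W = removeVertex u (removeVertex v W)

  removeEdge-true : ∀ {n u v} {W : Fin n → Bool} {p} → removeEdge u v W p ≡ true →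
    (p == u) ≡ false × (p == v) ≡ false × W p ≡ true
  removeEdge-true {p = p} h with ∧-true {not (p == _)} h
  ... | p≠u , h' with ∧-true {not (p == _)} h'
  ... | p≠v , Wp = not-true p≠u , not-true p≠v , Wp
    where
    not-true : ∀ {a} → not a ≡ true → a ≡ false
    not-true {false} _ = ≡.refl

  removeEdge-intro : ∀ {n} {u v : Fin n} {W p} → (p == u) ≡ false → (p == v) ≡ false → W p ≡ true →
    removeEdge u v W p ≡ true
  removeEdge-intro p≠u p≠v Wp rewrite p≠u | p≠v | Wp = ≡.refl

  size-cong : ∀ {n} (V W : Fin n → Bool) → (∀ p → V p ≡ W p) → size V ≡ size W
  size-cong {zero} V W h = ≡.refl
  size-cong {suc n} V W h rewrite h zero = ≡.cong (_ ℕ.+_) (size-cong (V ∘ suc) (W ∘ suc) (h ∘ suc))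

  size-removeVertex : ∀ {n} (W : Fin n → Bool) p → W p ≡ true → size W ≡ suc (size (removeVertex p W))
  size-removeVertex {suc n} W zero Wp rewrite Wp = ≡.refl
  size-removeVertex {suc n} W (suc p) Wp = ≡.trans
    (≡.cong ((if W zero then 1 else 0) ℕ.+_)
      (≡.trans (size-removeVertex (W ∘ suc) p Wp)
               (≡.cong suc (size-cong _ _ (λ q → ≡.cong (λ b → not b ∧ W (suc q)) (≡.sym (==-punchIn zero q p)))))))
    (ℕₚ.+-suc _ _)

  size-removeEdge : ∀ {n} (W : Fin n → Bool) u v → u ≢ v → W u ≡ true → W v ≡ true →
    size W ≡ 2 ℕ.+ size (removeEdge u v W)
  size-removeEdge W u v u≢v Wu Wv = ≡.trans (size-removeVertex W v Wv)
    (≡.cong suc (size-removeVertex (removeVertex v W) u (≡.trans (≡.cong (λ b → not b ∧ W u) (==-≢ u≢v)) Wu)))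

  full : ∀ {n} → Fin n → Bool
  full _ = true

  size-full : ∀ n → size (full {n}) ≡ n
  size-full zero = ≡.refl
  size-full (suc n) = ≡.cong suc (size-full n)

module Matchings (N : ℕ) where
  open VertexSets

  Edges : ℕ → Set
  Edges m = Fin m → Fin N × Fin N

  Loopless : ∀ {m} → Edges m → Set
  Loopless e = ∀ j → proj₁ (e j) ≢ proj₂ (e j)

  Ordered : ∀ {m} → Edges m → Set
  Ordered e = ∀ j → toℕ (proj₁ (e j)) ℕ.< toℕ (proj₂ (e j))

  ordered⇒loopless : ∀ {m} {e : Edges m} → Ordered e → Loopless e
  ordered⇒loopless o j u≡v = ℕₚ.<-irrefl (≡.cong toℕ u≡v) (o j)

  -- It scans the edges in order; a selected edge uses up both
  -- of its endpoints, which is the recursion satisfied by the matching polynomial.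
  matchingIn : ∀ {m} → Edges m → (Fin N → Bool) → (Fin m → Bool) → Bool
  matchingIn {zero} e W S = true
  matchingIn {suc m} e W S = if S zero
    then W (proj₁ (e zero)) ∧ W (proj₂ (e zero)) ∧ matchingIn (e ∘ suc) (removeEdge (proj₁ (e zero)) (proj₂ (e zero)) W) (S ∘ suc)
    else matchingIn (e ∘ suc) W (S ∘ suc)

  Inside : ∀ {m} → Edges m → (Fin N → Bool) → (Fin m → Bool) → Set
  Inside e W S = ∀ j → S j ≡ true → W (proj₁ (e j)) ≡ true × W (proj₂ (e j)) ≡ true

  Disjoint : ∀ {m} → Edges m → (Fin m → Bool) → Set
  Disjoint e S = ∀ j j' → S j ≡ true → S j' ≡ true → j ≢ j' → shareVertex (e j) (e j') ≡ false

  disjoint-intro : ∀ (a b c d : Fin N) → (a == c) ≡ false → (a == d) ≡ false → (b == c) ≡ false → (b == d) ≡ false →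
    shareVertex (a , b) (c , d) ≡ false
  disjoint-intro a b c d h₁ h₂ h₃ h₄ rewrite h₁ | h₂ | h₃ | h₄ = ≡.refl

  disjoint-elim : ∀ (a b c d : Fin N) → shareVertex (a , b) (c , d) ≡ false →
    (c == a) ≡ false × (d == a) ≡ false × (c == b) ≡ false × (d == b) ≡ false
  disjoint-elim a b c d h with a == c in ac | a == d in ad | b == c in bc | b == d in bd
  ... | false | false | false | false = ==-false-sym ac , ==-false-sym ad , ==-false-sym bc , ==-false-sym bd

  avoids-first : ∀ u v W p q → removeEdge u v W p ≡ true → removeEdge u v W q ≡ true →
    shareVertex (u , v) (p , q) ≡ false × shareVertex (p , q) (u , v) ≡ false
  avoids-first u v W p q hp hq with removeEdge-true {u = u} {v} {W} {p} hp | removeEdge-true {u = u} {v} {W} {q} hq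
  ... | p≠u , p≠v , _ | q≠u , q≠v , _ =
    disjoint-intro u v p q (==-false-sym p≠u) (==-false-sym q≠u) (==-false-sym p≠v) (==-false-sym q≠v)
    , disjoint-intro p q u v p≠u p≠v q≠u q≠v

  matchingIn-sound : ∀ {m} (e : Edges m) W S → matchingIn e W S ≡ true → Inside e W S × Disjoint e S
  matchingIn-sound {zero} e W S h = (λ ()) , (λ ())
  matchingIn-sound {suc m} e W S h with S zero in S₀
  ... | false = inside , disjoint
    where
    IH = matchingIn-sound (e ∘ suc) W (S ∘ suc) h
    inside : Inside e W S
    inside zero S₀≡t = ⊥-elim (true≢false (≡.trans (≡.sym S₀≡t) S₀))
    inside (suc j) = proj₁ IH j
    disjoint : Disjoint e S
    disjoint zero _ S₀≡t _ _ = ⊥-elim (true≢false (≡.trans (≡.sym S₀≡t) S₀))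
    disjoint (suc j) zero _ S₀≡t _ = ⊥-elim (true≢false (≡.trans (≡.sym S₀≡t) S₀))
    disjoint (suc j) (suc j') sj sj' j≢j' = proj₂ IH j j' sj sj' (j≢j' ∘ ≡.cong suc)
  ... | true with ∧-true {W (proj₁ (e zero))} h
  ...   | Wu , h' with ∧-true {W (proj₂ (e zero))} h'
  ...     | Wv , h'' = inside , disjoint
    where
    u = proj₁ (e zero)
    v = proj₂ (e zero)
    IH = matchingIn-sound (e ∘ suc) (removeEdge u v W) (S ∘ suc) h''
    inside : Inside e W S
    inside zero _ = Wu , Wv
    inside (suc j) sj = proj₂ (proj₂ (removeEdge-true {u = u} {v} {W} (proj₁ (proj₁ IH j sj))))
                      , proj₂ (proj₂ (removeEdge-true {u = u} {v} {W} (proj₂ (proj₁ IH j sj))))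
    disjoint : Disjoint e S
    disjoint zero zero _ _ 0≢0 = ⊥-elim (0≢0 ≡.refl)
    disjoint zero (suc j') _ sj' _ = proj₁ (avoids-first u v W (proj₁ (e (suc j'))) (proj₂ (e (suc j'))) (proj₁ (proj₁ IH j' sj')) (proj₂ (proj₁ IH j' sj')))
    disjoint (suc j) zero sj _ _ = proj₂ (avoids-first u v W (proj₁ (e (suc j))) (proj₂ (e (suc j))) (proj₁ (proj₁ IH j sj)) (proj₂ (proj₁ IH j sj)))
    disjoint (suc j) (suc j') sj sj' j≢j' = proj₂ IH j j' sj sj' (j≢j' ∘ ≡.cong suc)

  matchingIn-complete : ∀ {m} (e : Edges m) W S → Inside e W S → Disjoint e S → matchingIn e W S ≡ true
  matchingIn-complete {zero} e W S inside disjoint = ≡.refl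
  matchingIn-complete {suc m} e W S inside disjoint with S zero in S₀
  ... | false = matchingIn-complete (e ∘ suc) W (S ∘ suc) (inside ∘ suc)
                  (λ j j' sj sj' j≢j' → disjoint (suc j) (suc j') sj sj' (j≢j' ∘ Finₚ.suc-injective))
  ... | true rewrite proj₁ (inside zero S₀) | proj₂ (inside zero S₀) =
    matchingIn-complete (e ∘ suc) (removeEdge u v W) (S ∘ suc) inside'
      (λ j j' sj sj' j≢j' → disjoint (suc j) (suc j') sj sj' (j≢j' ∘ Finₚ.suc-injective))
    where
    u = proj₁ (e zero)
    v = proj₂ (e zero)
    -- the later selected edges avoid u and v, so they lie inside W minus {u,v}
    inside' : Inside (e ∘ suc) (removeEdge u v W) (S ∘ suc)
    inside' j sj with disjoint-elim u v (proj₁ (e (suc j))) (proj₂ (e (suc j))) (disjoint zero (suc j) S₀ sj (λ ()))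
    ... | p≠u , q≠u , p≠v , q≠v = removeEdge-intro {W = W} p≠u p≠v (proj₁ (inside (suc j) sj))
                                , removeEdge-intro {W = W} q≠u q≠v (proj₂ (inside (suc j) sj))

  isMatching⇒Disjoint : (G : Graph N) (S : Fin (m G) → Bool) → isMatching G S ≡ true → Disjoint (edge G) S
  isMatching⇒Disjoint G S h j j' sj sj' j≢j' =
    pairTest (S j) (S j') (j == j') _ sj sj' (==-≢ j≢j') (allᵇ-elim _ (allᵇ-elim _ h j) j')
    where
    pairTest : ∀ a b c d → a ≡ true → b ≡ true → c ≡ false → not (a ∧ b ∧ not c ∧ d) ≡ true → d ≡ false
    pairTest true true false false _ _ _ _ = ≡.refl

  Disjoint⇒isMatching : (G : Graph N) (S : Fin (m G) → Bool) → Disjoint (edge G) S → isMatching G S ≡ true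
  Disjoint⇒isMatching G S disjoint = allᵇ-intro _ (λ j → allᵇ-intro _ (λ j' →
    pairTest (S j) (S j') (j == j') _ (λ sj sj' j≠j' → disjoint j j' sj sj' (==-false⇒≢ j≠j'))))
    where
    pairTest : ∀ a b c d → (a ≡ true → b ≡ true → c ≡ false → d ≡ false) → not (a ∧ b ∧ not c ∧ d) ≡ true
    pairTest false b c d h = ≡.refl
    pairTest true false c d h = ≡.refl
    pairTest true true true d h = ≡.refl
    pairTest true true false false h = ≡.refl
    pairTest true true false true h = ⊥-elim (true≢false (h ≡.refl ≡.refl ≡.refl))

  matchingIn-full : (G : Graph N) (S : Fin (m G) → Bool) → matchingIn (edge G) full S ≡ isMatching G S
  matchingIn-full G S with isMatching G S in isM
  ... | true = matchingIn-complete (edge G) full S (λ _ _ → ≡.refl , ≡.refl) (isMatching⇒Disjoint G S isM)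
  ... | false with matchingIn (edge G) full S in isM'
  ...   | false = ≡.refl
  ...   | true = ⊥-elim (true≢false (≡.trans (≡.sym (Disjoint⇒isMatching G S
                   (proj₂ (matchingIn-sound (edge G) full S isM')))) isM))

  matchingIn-size : ∀ {m} (e : Edges m) → Loopless e → ∀ W S → matchingIn e W S ≡ true → 2 ℕ.* size S ℕ.≤ size W
  matchingIn-size {zero} e loopless W S h = ℕ.z≤n
  matchingIn-size {suc m} e loopless W S h with S zero
  ... | false = matchingIn-size (e ∘ suc) (loopless ∘ suc) W (S ∘ suc) h
  ... | true with ∧-true {W (proj₁ (e zero))} h
  ...   | Wu , h' with ∧-true {W (proj₂ (e zero))} h'
  ...     | Wv , h'' = begin
    2 ℕ.* suc (size (S ∘ suc))             ≡⟨ ℕₚ.*-distribˡ-+ 2 1 (size (S ∘ suc)) ⟩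
    2 ℕ.+ 2 ℕ.* size (S ∘ suc)             ≤⟨ ℕₚ.+-monoʳ-≤ 2 (matchingIn-size (e ∘ suc) (loopless ∘ suc) W' (S ∘ suc) h'') ⟩
    2 ℕ.+ size W'                          ≡⟨ ≡.sym (size-removeEdge W u v (loopless zero) Wu Wv) ⟩
    size W                                 ∎
    where
    open ℕₚ.≤-Reasoning
    u = proj₁ (e zero)
    v = proj₂ (e zero)
    W' = removeEdge u v W

  matching-bound : (G : Graph N) (S : Fin (m G) → Bool) → isMatching G S ≡ true → size S ℕ.< suc (N / 2)
  matching-bound G S isM = ℕ.s≤s (begin
    size S                 ≡⟨ ≡.sym (m*n/n≡m (size S) 2) ⟩
    size S ℕ.* 2 / 2       ≤⟨ /-monoˡ-≤ 2 (≡.subst (ℕ._≤ N) (ℕₚ.*-comm 2 (size S)) twice) ⟩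
    N / 2                  ∎)
    where
    open ℕₚ.≤-Reasoning
    twice : 2 ℕ.* size S ℕ.≤ N
    twice = ≡.subst (2 ℕ.* size S ℕ.≤_) (size-full N)
              (matchingIn-size (edge G) (ordered⇒loopless (ordered G)) full S (≡.trans (matchingIn-full G S) isM))

module MatchingPolynomial {c ℓ : Level} (R : CommutativeRing c ℓ) (x : CommutativeRing.Carrier R) (N : ℕ) where
  open CommutativeRing R hiding (zero)
  open WithRing R
  open Sums R
  open Determinants R using (sgn)
  open VertexSets
  open Matchings N
  open import Relation.Binary.Reasoning.Setoid setoid
  open import Algebra.Properties.Ring ring using (-1*x≈-x; -‿distribˡ-*; -0#≈0#)

  μ : ∀ {m} → Edges m → (Fin N → Bool) → Carrier
  μ {zero} e W = x ^ size W
  μ {suc m} e W = μ (e ∘ suc) W - χ (W u ∧ W v) * μ (e ∘ suc) (removeEdge u v W)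
    where
    u = proj₁ (e zero)
    v = proj₂ (e zero)

  matchingTerm : ∀ {m} → Edges m → (Fin N → Bool) → (Fin m → Bool) → Carrier
  matchingTerm e W S = χ (matchingIn e W S) * (sgn (size S) * x ^ (size W ℕ.∸ 2 ℕ.* size S))

  matchingSum : ∀ m → Edges m → (Fin N → Bool) → Carrier
  matchingSum m e W = listSum (map (matchingTerm e W) (allFuns (true ∷ false ∷ []) m))

  matchingTerm-first : ∀ {m} (e : Edges (suc m)) → Loopless e → ∀ W S' →
    let u = proj₁ (e zero); v = proj₂ (e zero) in
    χ (W u ∧ W v ∧ matchingIn (e ∘ suc) (removeEdge u v W) S')
      * (sgn (suc (size S')) * x ^ (size W ℕ.∸ 2 ℕ.* suc (size S')))
    ≈ (- χ (W u ∧ W v)) * matchingTerm (e ∘ suc) (removeEdge u v W) S'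
  matchingTerm-first e loopless W S' with W (proj₁ (e zero)) in Wu | W (proj₂ (e zero)) in Wv
  ... | false | _ = trans (zeroˡ _) (sym (trans (*-congʳ -0#≈0#) (zeroˡ _)))
  ... | true | false = trans (zeroˡ _) (sym (trans (*-congʳ -0#≈0#) (zeroˡ _)))
  ... | true | true = begin
    χ M * (sgn (suc s) * x ^ (size W ℕ.∸ 2 ℕ.* suc s))
      ≈⟨ *-congˡ (*-congˡ (reflexive (≡.cong (x ^_) (≡.trans (≡.cong (ℕ._∸ 2 ℕ.* suc s) sizeW) (exponent (size W') s))))) ⟩
    χ M * (((- 1#) * sgn s) * x ^ (size W' ℕ.∸ 2 ℕ.* s))
      ≈⟨ solve 4 (λ m n σ y → m :* ((n :* σ) :* y) := n :* (m :* (σ :* y))) refl (χ M) (- 1#) (sgn s) _ ⟩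
    (- 1#) * (χ M * (sgn s * x ^ (size W' ℕ.∸ 2 ℕ.* s))) ∎
    where
    open Solver
    u = proj₁ (e zero)
    v = proj₂ (e zero)
    W' = removeEdge u v W
    M = matchingIn (e ∘ suc) W' S'
    s = size S'
    sizeW : size W ≡ 2 ℕ.+ size W'
    sizeW = size-removeEdge W u v (loopless zero) Wu Wv
    exponent : ∀ w s → (2 ℕ.+ w) ℕ.∸ 2 ℕ.* suc s ≡ w ℕ.∸ 2 ℕ.* s
    exponent w s rewrite ℕₚ.+-suc s (s ℕ.+ 0) = ≡.refl

  μ≈matchingSum : ∀ m (e : Edges m) → Loopless e → ∀ W → μ e W ≈ matchingSum m e W
  μ≈matchingSum zero e loopless W = sym (trans (+-identityʳ _) (trans (*-identityˡ _) (*-identityˡ _)))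
  μ≈matchingSum (suc m) e loopless W = begin
    μ e' W - χᵤᵥ * μ e' W'
      ≈⟨ +-cong (μ≈matchingSum m e' (loopless ∘ suc) W) (-‿distribˡ-* χᵤᵥ _) ⟩
    matchingSum m e' W + (- χᵤᵥ) * μ e' W'
      ≈⟨ +-congˡ (*-congˡ (μ≈matchingSum m e' (loopless ∘ suc) W')) ⟩
    matchingSum m e' W + (- χᵤᵥ) * matchingSum m e' W'
      ≈⟨ +-comm _ _ ⟩
    (- χᵤᵥ) * matchingSum m e' W' + matchingSum m e' W
      ≈⟨ +-cong (sym (trans (listSum-cong L (matchingTerm-first e loopless W)) (listSum-*ˡ (- χᵤᵥ) (matchingTerm e' W') L)))
                (sym (+-identityʳ _)) ⟩
    listSum (map (F true) L) + (listSum (map (F false) L) + 0#)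
      ≈⟨ sym (listSum-allFuns (true ∷ false ∷ []) m F) ⟩
    matchingSum (suc m) e W ∎
    where
    u = proj₁ (e zero)
    v = proj₂ (e zero)
    e' = e ∘ suc
    W' = removeEdge u v W
    χᵤᵥ = χ (W u ∧ W v)
    L = allFuns (true ∷ false ∷ []) m
    -- the term of S = b ∷ S'
    F : Bool → (Fin m → Bool) → Carrier
    F b S' = χ (if b then W u ∧ W v ∧ matchingIn e' W' S' else matchingIn e' W S')
      * (sgn ((if b then 1 else 0) ℕ.+ size S') * x ^ (size W ℕ.∸ 2 ℕ.* ((if b then 1 else 0) ℕ.+ size S')))

  matchingPoly≈matchingSum : (G : Graph N) → matchingPoly G x ≈ matchingSum (m G) (edge G) full
  matchingPoly≈matchingSum G = begin
    sum {suc (N / 2)} (λ j → sgn (toℕ j) * ((matchingNumber G (toℕ j) ·ℕ 1#) * x ^ (N ℕ.∸ 2 ℕ.* toℕ j)))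
      ≈⟨ sum-cong-≋ {suc (N / 2)} (λ j → trans (*-congˡ (length-filter (isSize j) subsets _))
                                 (sym (listSum-*ˡ (sgn (toℕ j)) (λ S → χ (isSize j S) * x ^ (N ℕ.∸ 2 ℕ.* toℕ j)) subsets))) ⟩
    sum {suc (N / 2)} (λ j → listSum (map (term j) subsets))
      ≈⟨ sum-listSum-swap (suc (N / 2)) term subsets ⟩
    listSum (map (λ S → sum {suc (N / 2)} (λ j → term j S)) subsets)
      ≈⟨ listSum-cong subsets pick ⟩
    matchingSum (m G) (edge G) full ∎
    where
    subsets = edgeSubsets G
    isSize : Fin (suc (N / 2)) → (Fin (m G) → Bool) → Bool
    isSize j S = isMatching G S ∧ ⌊ size S ℕ.≟ toℕ j ⌋
    term : Fin (suc (N / 2)) → (Fin (m G) → Bool) → Carrier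
    term j S = sgn (toℕ j) * (χ (isSize j S) * x ^ (N ℕ.∸ 2 ℕ.* toℕ j))
    atSize : ∀ s t → t ≡ s → sgn t * (χ ⌊ s ℕ.≟ t ⌋ * x ^ (N ℕ.∸ 2 ℕ.* t)) ≈ sgn s * x ^ (N ℕ.∸ 2 ℕ.* s)
    atSize s .s ≡.refl with s ℕ.≟ s
    ... | yes _ = *-congˡ (*-identityˡ _)
    ... | no s≢s = ⊥-elim (s≢s ≡.refl)
    offSize : ∀ s t → t ≢ s → sgn t * (χ ⌊ s ℕ.≟ t ⌋ * x ^ (N ℕ.∸ 2 ℕ.* t)) ≈ 0#
    offSize s t t≢s with s ℕ.≟ t
    ... | yes s≡t = ⊥-elim (t≢s (≡.sym s≡t))
    ... | no _ = trans (*-congˡ (zeroˡ _)) (zeroʳ _)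
    pickSize : ∀ (S : Fin (m G) → Bool) b → (b ≡ true → size S ℕ.< suc (N / 2)) →
      sum {suc (N / 2)} (λ j → sgn (toℕ j) * (χ (b ∧ ⌊ size S ℕ.≟ toℕ j ⌋) * x ^ (N ℕ.∸ 2 ℕ.* toℕ j)))
        ≈ χ b * (sgn (size S) * x ^ (N ℕ.∸ 2 ℕ.* size S))
    pickSize S false _ = trans (sum-zero {suc (N / 2)} (λ j → sgn (toℕ j) * (0# * x ^ (N ℕ.∸ 2 ℕ.* toℕ j))) (λ j → trans (*-congˡ (zeroˡ _)) (zeroʳ _)))
                               (sym (zeroˡ _))
    pickSize S true bound = begin
      sum {suc (N / 2)} (λ j → t (toℕ j))  ≈⟨ sum-pick j₀ (λ j → t (toℕ j)) (λ j j≢j₀ → offSize (size S) (toℕ j) (j≢j₀ ∘ toℕ≡)) ⟩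
      t (toℕ j₀)             ≈⟨ atSize (size S) (toℕ j₀) (Finₚ.toℕ-fromℕ< (bound ≡.refl)) ⟩
      sgn (size S) * x ^ (N ℕ.∸ 2 ℕ.* size S) ≈⟨ sym (*-identityˡ _) ⟩
      1# * (sgn (size S) * x ^ (N ℕ.∸ 2 ℕ.* size S)) ∎
      where
      t : ℕ → Carrier
      t n = sgn n * (χ ⌊ size S ℕ.≟ n ⌋ * x ^ (N ℕ.∸ 2 ℕ.* n))
      j₀ = fromℕ< (bound ≡.refl)
      toℕ≡ : ∀ {j} → toℕ j ≡ size S → j ≡ j₀
      toℕ≡ eq = Finₚ.toℕ-injective (≡.trans eq (≡.sym (Finₚ.toℕ-fromℕ< (bound ≡.refl))))
    pick : ∀ S → sum {suc (N / 2)} (λ j → term j S) ≈ matchingTerm (edge G) full S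
    pick S = trans (pickSize S (isMatching G S) (matching-bound G S))
      (reflexive (≡.cong₂ (λ b n → χ b * (sgn (size S) * x ^ (n ℕ.∸ 2 ℕ.* size S)))
                          (≡.sym (matchingIn-full G S)) (≡.sym (size-full N))))

module Expectation {c ℓ : Level} (R : CommutativeRing c ℓ) (k : ℕ) (ξ : CommutativeRing.Carrier R)
                   (i : ℕ) (x : CommutativeRing.Carrier R) (N : ℕ) where
  open CommutativeRing R hiding (zero)
  open WithRing R
  open Sums R
  open Determinants R
  open RootsOfUnity R using (weight; weight')
  open VertexSets
  open Matchings N using (Edges; Ordered; ordered⇒loopless)
  open MatchingPolynomial R x N using (μ)
  open import Relation.Binary.Reasoning.Setoid setoid
  open import Algebra.Properties.Ring ring using (-1*x≈-x; -‿distribˡ-*; -‿distribʳ-*; -‿involutive; -0#≈0#)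
  open import Algebra.Properties.AbelianGroup +-abelianGroup using (⁻¹-∙-comm)
  open import Algebra.Properties.Semiring.Mult semiring using (×1-homo-*)

  ω ω' : Fin k → Carrier
  ω = weight k ξ i
  ω' = weight' k ξ i

  graph : ∀ m (e : Edges m) → Ordered e → Injective _≡_ _≡_ e → Graph N
  graph m e o d = record { m = m ; edge = e ; ordered = o ; distinct = d }

  -- Rows of xI - A^{s,i} for the vertices in W, rows of the identity elsewhere;
  -- its determinant is the characteristic polynomial of the subgraph induced on W.
  restricted : (G : Graph N) → Signature G k → (Fin N → Bool) → Matrix N
  restricted G s W p b = if W p then scalarMat x p b - sigAdj G k ξ s i p b else unit p b

  -- Base case: without edges the restricted matrix is diagonal.
  expected-noEdges : ∀ (e : Edges 0) (o : Ordered e) (d : Injective _≡_ _≡_ e) W →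
    listSum (map (λ s → det (restricted (graph 0 e o d) s W)) (allSignatures (graph 0 e o d) k))
      ≈ ((k ℕ.^ 0) ·ℕ 1#) * μ e W
  expected-noEdges e o d W = begin
    det (restricted G (λ ()) W) + 0#         ≈⟨ +-identityʳ _ ⟩
    det (restricted G (λ ()) W)              ≈⟨ det-diagonal _ (λ p → if W p then x else 1#) diagonal ⟩
    diagProduct (λ p → if W p then x else 1#) ≈⟨ product W ⟩
    x ^ size W                               ≈⟨ sym (*-identityˡ _) ⟩
    1# * x ^ size W                          ≈⟨ *-congʳ (sym (+-identityʳ 1#)) ⟩
    (1# + 0#) * x ^ size W                   ∎
    where
    G = graph 0 e o d
    diagonal : ∀ p b → restricted G (λ ()) W p b ≈ unit p b * (if W p then x else 1#)
    diagonal p b with W p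
    ... | false = sym (*-identityʳ _)
    ... | true rewrite ==-sym p b with b == p
    ...   | true = trans (+-congˡ -0#≈0#) (trans (+-identityʳ x) (sym (*-identityˡ x)))
    ...   | false = trans (+-congˡ -0#≈0#) (trans (+-identityʳ 0#) (sym (zeroˡ x)))
    product : ∀ {n} (V : Fin n → Bool) → diagProduct (λ p → if V p then x else 1#) ≈ x ^ size V
    product {zero} V = refl
    product {suc n} V with V zero
    ... | true = *-congˡ (product (V ∘ suc))
    ... | false = trans (*-identityˡ _) (product (V ∘ suc))

  restricted-removeVertex : ∀ G s W p a b → restricted G s (removeVertex p W) a b ≈ setRow p (unit p) (restricted G s W) a b
  restricted-removeVertex G s W p = rowCases p atP offP
    where
    atP : ∀ b → restricted G s (removeVertex p W) p b ≈ setRow p (unit p) (restricted G s W) p b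
    atP b rewrite ==-refl p = refl
    offP : ∀ a → a ≢ p → ∀ b → restricted G s (removeVertex p W) a b ≈ setRow p (unit p) (restricted G s W) a b
    offP a a≢p b rewrite ==-≢ a≢p = refl

  module FirstEdge {m} (e : Edges (suc m)) (o : Ordered e) (d : Injective _≡_ _≡_ e) (W : Fin N → Bool) where
    u v : Fin N
    u = proj₁ (e zero)
    v = proj₂ (e zero)

    u≢v : u ≢ v
    u≢v = ordered⇒loopless o zero

    v≢u : v ≢ u
    v≢u = u≢v ∘ ≡.sym

    G G' : Graph N
    G = graph (suc m) e o d
    G' = graph m (e ∘ suc) (o ∘ suc) (Finₚ.suc-injective ∘ d)

    edgeEntry : Fin k → Fin N → Fin N → Carrier
    edgeEntry a p b = (if (u == p) ∧ (v == b) then ω a else 0#) + (if (u == b) ∧ (v == p) then ω' a else 0#)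

    edgeEntry-u : ∀ a b → edgeEntry a u b ≈ ω a * unit v b
    edgeEntry-u a b rewrite ==-refl u | ==-≢ v≢u | ==-sym b v with v == b | u == b
    ... | true | true = trans (+-identityʳ _) (sym (*-identityʳ _))
    ... | true | false = trans (+-identityʳ _) (sym (*-identityʳ _))
    ... | false | true = trans (+-identityʳ _) (sym (zeroʳ _))
    ... | false | false = trans (+-identityʳ _) (sym (zeroʳ _))

    edgeEntry-v : ∀ a b → edgeEntry a v b ≈ ω' a * unit u b
    edgeEntry-v a b rewrite ==-≢ u≢v | ==-refl v | ==-sym b u with u == b
    ... | true = trans (+-identityˡ _) (sym (*-identityʳ _))
    ... | false = trans (+-identityˡ _) (sym (zeroʳ _))

    edgeEntry-off : ∀ a p b → p ≢ u → p ≢ v → edgeEntry a p b ≈ 0#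
    edgeEntry-off a p b p≢u p≢v rewrite ==-≢ (p≢u ∘ ≡.sym) | ==-≢ (p≢v ∘ ≡.sym) with u == b
    ... | true = +-identityˡ 0#
    ... | false = +-identityˡ 0#

    restricted-split : ∀ s p b →
      restricted G s W p b ≈ restricted G' (s ∘ suc) W p b + (- χ (W p)) * edgeEntry (s zero) p b
    restricted-split s p b with W p
    ... | true = begin
      S - (T + A)       ≈⟨ +-congˡ (sym (⁻¹-∙-comm T A)) ⟩
      S + (- T + - A)   ≈⟨ solve 3 (λ s t a → s :+ (t :+ a) := (s :+ a) :+ t) refl S (- T) (- A) ⟩
      (S - A) + - T     ≈⟨ +-congˡ (sym (-1*x≈-x T)) ⟩
      (S - A) + (- 1#) * T ∎
      where
      open Solver
      S = scalarMat x p b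
      T = edgeEntry (s zero) p b
      A = sigAdj G' k ξ (s ∘ suc) i p b
    ... | false = sym (trans (+-congˡ (trans (*-congʳ -0#≈0#) (zeroˡ _))) (+-identityʳ _))

    -- The first edge adds α a · e_v to row u and β a · e_u to row v.
    α β : Fin k → Carrier
    α a = (- χ (W u)) * ω a
    β a = (- χ (W v)) * ω' a

    M₀ : Signature G' k → Matrix N
    M₀ f = restricted G' f W

    D₀ Dᵤ Dᵥ Dᵤᵥ : Signature G' k → Carrier
    D₀ f = det (M₀ f)
    Dᵤ f = det (setRow u (unit v) (M₀ f))
    Dᵥ f = det (setRow v (unit u) (M₀ f))
    Dᵤᵥ f = det (setRow u (unit v) (setRow v (unit u) (M₀ f)))

    expansion : Fin k → Signature G' k → Carrier
    expansion a f = D₀ f + α a * Dᵤ f + β a * Dᵥ f + (α a * β a) * Dᵤᵥ f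

    det-expand : ∀ s → det (restricted G s W) ≈ expansion (s zero) (s ∘ suc)
    det-expand s = det-twoRows (restricted G s W) (M₀ (s ∘ suc)) u v u≢v (α a) (β a) (unit v) (unit u)
      (λ b → trans (restricted-split s u b) (+-congˡ (trans (*-congˡ (edgeEntry-u a b)) (sym (*-assoc _ _ _)))))
      (λ b → trans (restricted-split s v b) (+-congˡ (trans (*-congˡ (edgeEntry-v a b)) (sym (*-assoc _ _ _)))))
      (λ p b p≢u p≢v → trans (restricted-split s p b)
        (trans (+-congˡ (trans (*-congˡ (edgeEntry-off a p b p≢u p≢v)) (zeroʳ _))) (+-identityʳ _)))
      where a = s zero

    -- Rows u and v equal to e_v and e_u: a transposition away from deleting u and v.
    Dᵤᵥ≈-restricted : ∀ f → Dᵤᵥ f ≈ - det (restricted G' f (removeEdge u v W))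
    Dᵤᵥ≈-restricted f = trans (det-swapUnits (M₀ f) u v u≢v) (-‿cong (det-cong (λ p b → sym (begin
      restricted G' f (removeVertex u (removeVertex v W)) p b
        ≈⟨ restricted-removeVertex G' f (removeVertex v W) u p b ⟩
      setRow u (unit u) (restricted G' f (removeVertex v W)) p b
        ≈⟨ setRow-congʳ u (unit u) (restricted-removeVertex G' f W v) p b ⟩
      setRow u (unit u) (setRow v (unit v) (M₀ f)) p b ∎))))

    module Averaging (ω-sum : sum ω ≈ 0#) (ω'-sum : sum ω' ≈ 0#) (ωω'≈1 : ∀ a → ω a * ω' a ≈ 1#) where

      k1 = k ·ℕ 1#
      χᵤᵥ = χ (W u ∧ W v)
      W' = removeEdge u v W

      α-sum : sum α ≈ 0#
      α-sum = trans (sym (*-distribˡ-sum (- χ (W u)) ω)) (trans (*-congˡ ω-sum) (zeroʳ _))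

      β-sum : sum β ≈ 0#
      β-sum = trans (sym (*-distribˡ-sum (- χ (W v)) ω')) (trans (*-congˡ ω'-sum) (zeroʳ _))

      αβ-sum : sum (λ a → α a * β a) ≈ k1 * χᵤᵥ
      αβ-sum = trans (sum-cong-≋ αβ≈χᵤᵥ) (sum-const k χᵤᵥ)
        where
        αβ≈χᵤᵥ : ∀ a → α a * β a ≈ χᵤᵥ
        αβ≈χᵤᵥ a = begin
          ((- χ (W u)) * ω a) * ((- χ (W v)) * ω' a)
            ≈⟨ solve 4 (λ p w q w' → (p :* w) :* (q :* w') := (p :* q) :* (w :* w')) refl (- χ (W u)) (ω a) (- χ (W v)) (ω' a) ⟩
          ((- χ (W u)) * (- χ (W v))) * (ω a * ω' a)
            ≈⟨ *-cong (trans (sym (-‿distribˡ-* _ _)) (trans (-‿cong (sym (-‿distribʳ-* _ _))) (-‿involutive _))) (ωω'≈1 a) ⟩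
          (χ (W u) * χ (W v)) * 1#
            ≈⟨ trans (*-identityʳ _) (sym (χ-∧ (W u) (W v))) ⟩
          χᵤᵥ ∎
          where open Solver

      average : ∀ f → listSum (map (λ a → expansion a f) (allFin k))
                        ≈ k1 * D₀ f + (k1 * - χᵤᵥ) * det (restricted G' f W')
      average f = begin
        listSum (map (λ a → expansion a f) (allFin k))
          ≈⟨ listSum-allFin (λ a → expansion a f) ⟩
        sum (λ a → expansion a f)
          ≈⟨ sum-bilinear α β (D₀ f) (Dᵤ f) (Dᵥ f) (Dᵤᵥ f) α-sum β-sum ⟩
        k1 * D₀ f + sum (λ a → α a * β a) * Dᵤᵥ f
          ≈⟨ +-congˡ (*-cong αβ-sum (Dᵤᵥ≈-restricted f)) ⟩
        k1 * D₀ f + (k1 * χᵤᵥ) * - det (restricted G' f W')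
          ≈⟨ +-congˡ (trans (sym (-‿distribʳ-* _ _)) (trans (-‿distribˡ-* _ _) (*-congʳ (-‿distribʳ-* k1 χᵤᵥ)))) ⟩
        k1 * D₀ f + (k1 * - χᵤᵥ) * det (restricted G' f W') ∎

      expected-step : ∀ K →
        listSum (map D₀ (allSignatures G' k)) ≈ K * μ (e ∘ suc) W →
        listSum (map (λ f → det (restricted G' f W')) (allSignatures G' k)) ≈ K * μ (e ∘ suc) W' →
        listSum (map (λ s → det (restricted G s W)) (allSignatures G k)) ≈ (k1 * K) * μ e W
      expected-step K IH IH' = begin
        listSum (map (λ s → det (restricted G s W)) (allFuns (allFin k) (suc m)))
          ≈⟨ listSum-cong (allFuns (allFin k) (suc m)) det-expand ⟩
        listSum (map (λ s → expansion (s zero) (s ∘ suc)) (allFuns (allFin k) (suc m)))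
          ≈⟨ listSum-allFuns (allFin k) m expansion ⟩
        listSum (map (λ a → listSum (map (expansion a) L)) (allFin k))
          ≈⟨ listSum-swap expansion (allFin k) L ⟩
        listSum (map (λ f → listSum (map (λ a → expansion a f) (allFin k))) L)
          ≈⟨ listSum-cong L average ⟩
        listSum (map (λ f → k1 * D₀ f + (k1 * - χᵤᵥ) * det (restricted G' f W')) L)
          ≈⟨ listSum-linear k1 (k1 * - χᵤᵥ) D₀ (λ f → det (restricted G' f W')) L ⟩
        k1 * listSum (map D₀ L) + (k1 * - χᵤᵥ) * listSum (map (λ f → det (restricted G' f W')) L)
          ≈⟨ +-cong (*-congˡ IH) (*-congˡ IH') ⟩
        k1 * (K * μ (e ∘ suc) W) + (k1 * - χᵤᵥ) * (K * μ (e ∘ suc) W')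
          ≈⟨ solve 5 (λ a b n p q → a :* (b :* p) :+ (a :* n) :* (b :* q) := (a :* b) :* (p :+ n :* q)) refl k1 K (- χᵤᵥ) _ _ ⟩
        (k1 * K) * (μ (e ∘ suc) W + (- χᵤᵥ) * μ (e ∘ suc) W')
          ≈⟨ *-congˡ (+-congˡ (sym (-‿distribˡ-* χᵤᵥ _))) ⟩
        (k1 * K) * μ e W ∎
        where
        open Solver
        L = allSignatures G' k

  expected-restricted : (sum ω ≈ 0#) → (sum ω' ≈ 0#) → (∀ a → ω a * ω' a ≈ 1#) →
    ∀ m (e : Edges m) (o : Ordered e) (d : Injective _≡_ _≡_ e) W →
    listSum (map (λ s → det (restricted (graph m e o d) s W)) (allSignatures (graph m e o d) k))
      ≈ ((k ℕ.^ m) ·ℕ 1#) * μ e W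
  expected-restricted ω-sum ω'-sum ωω'≈1 zero e o d W = expected-noEdges e o d W
  expected-restricted ω-sum ω'-sum ωω'≈1 (suc m) e o d W =
    trans (expected-step ((k ℕ.^ m) ·ℕ 1#) (IH W) (IH W')) (*-congʳ (sym (×1-homo-* k (k ℕ.^ m))))
    where
    open FirstEdge e o d W
    open Averaging ω-sum ω'-sum ωω'≈1
    IH = expected-restricted ω-sum ω'-sum ωω'≈1 m (e ∘ suc) (o ∘ suc) (Finₚ.suc-injective ∘ d)

-- For W = V the restricted matrix is xI - A^{s,i} itself, so its determinant is
-- charPoly; the hypothesis 2 ≤ k is implied by 1 ≤ i < k.
mainTheorem4 : {c ℓ : Level} (R : CommutativeRing c ℓ) →
    let open CommutativeRing R
        open WithRing R
    in NoZeroDivisors →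
       (k : ℕ) → 2 ≤ k →
       (ξ : Carrier) → ξ ^ k ≈ 1# → (∀ j → 1 ≤ j → j < k → ¬ (ξ ^ j ≈ 1#)) →
       {N : ℕ} (G : Graph N) →
       (i : ℕ) → 1 ≤ i → i < k →
       (x : Carrier) →
       listSum (Data.List.map (λ s → charPoly G k ξ s i x) (allSignatures G k))
         ≈ ((k Data.Nat.^ m G) ·ℕ 1#) * matchingPoly G x
mainTheorem4 R noZeroDivisors k _ ξ ξᵏ≈1 ξ-primitive {N} G i 1≤i i<k x = begin
  listSum (Data.List.map (λ s → charPoly G k ξ s i x) (allSignatures G k))
    ≈⟨ expected-restricted weight-sum weight'-sum weight-product (m G) (edge G) (ordered G) (distinct G) full ⟩
  ((k Data.Nat.^ m G) ·ℕ 1#) * μ (edge G) full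
    ≈⟨ *-congˡ (μ≈matchingSum (m G) (edge G) (ordered⇒loopless (ordered G)) full) ⟩
  ((k Data.Nat.^ m G) ·ℕ 1#) * matchingSum (m G) (edge G) full
    ≈⟨ *-congˡ (sym (matchingPoly≈matchingSum G)) ⟩
  ((k Data.Nat.^ m G) ·ℕ 1#) * matchingPoly G x ∎
  where
  open CommutativeRing R
  open WithRing R
  open import Relation.Binary.Reasoning.Setoid setoid
  open RootsOfUnity.Characters R noZeroDivisors k ξ ξᵏ≈1 ξ-primitive i 1≤i i<k
  open Expectation R k ξ i x N
  open MatchingPolynomial R x N
  open Matchings N using (ordered⇒loopless)
  open VertexSets using (full)
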